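{- Let $\Delta=(V,\mathcal{A})$ be a finite digraph (multiple arcs and multiple loops allowed), let $\tau_1,\tau_2:\mathcal{A}\to\mathbb{C}$ be arbitrary maps, and let $t$ be an indeterminate. Define $\theta:\mathcal{A}\times\mathcal{A}\to\mathbb{C}$ by $$\theta(a,a')=\tau_1(a)\tau_2(a')\,\delta_{\mathfrak{h}(a)\,\mathfrak{t}(a')}-\epsilon(a,a'),$$ where $\epsilon(a,a')=1$ if $a'$ is an inverse of $a$ and $\epsilon(a,a')=0$ otherwise, and let $M_\theta=(\theta(a,a'))_{a,a'\in\mathcal{A}}$. Fix a total order $\le$ on $V$, let $\Phi_\Delta=\{(u,v)\in V\times V : u\le v,\ \mathcal{A}(u,v)\neq\emptyset\}$, and for $(u,v)\in\Phi_\Delta$ let $J(u,v)$, $K(u,v)$, $L(u,v)$, $f(u,v)$ be as in the context. Put $$A^\theta_\Delta=\sum_{(u,v)\in\Phi_\Delta}L(u,v)K(u,v),\qquad \underline{D}^\theta_\Delta=\sum_{(u,v)\in\Phi_\Delta}\frac{L(u,v)J(u,v)K(u,v)}{f(u,v)},$$ $$\underline{X}^\theta_\Delta=\sum_{(u,v)\in\Phi_\Delta,\ u\neq v}\frac{L(u,v)J(u,v)^2K(u,v)}{f(u,v)}$$ (all $|V|\times|V|$ matrices with entries rational functions of $t$). Then $$\det(I-tM_\theta)=\prod_{(u,v)\in\Phi_\Delta}f(u,v)\cdot\det\!\left(I-tA^\theta_\Delta+t^2\underline{D}^\theta_\Delta-t^3\underline{X}^\theta_\Delta\right).$$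
   Context: For an arc $a$, $\mathfrak{t}(a)$ and $\mathfrak{h}(a)$ denote its tail and head. For $u,v\in V$, $\mathcal{A}_{uv}=\{a\in\mathcal{A}:\mathfrak{t}(a)=u,\ \mathfrak{h}(a)=v\}$ and $\mathcal{A}(u,v)=\mathcal{A}_{uv}\cup\mathcal{A}_{vu}$. Inverse convention for digraphs: for $a\in\mathcal{A}_{uv}$, every arc in $\mathcal{A}_{vu}$ is an inverse of $a$ (in particular any two loops at the same vertex, including a loop and itself, are inverses of each other). $\delta_{xy}$ is the Kronecker delta. For $(u,v)\in\Phi_\Delta$: $J(u,v)$ is the square matrix indexed by $\mathcal{A}(u,v)$ whose $(a,a')$ entry is $1$ if $a'$ is an inverse of $a$ and $0$ otherwise; $K(u,v)$ is the $\mathcal{A}(u,v)\times V$ matrix with $(a,w)$ entry $\tau_1(a)\delta_{\mathfrak{h}(a)w}$; $L(u,v)$ is the $V\times\mathcal{A}(u,v)$ matrix with $(w,a')$ entry $\tau_2(a')\delta_{w\,\mathfrak{t}(a')}$; and $f(u,v)=1+|\mathcal{A}_{uu}|t$ if $u=v$, $f(u,v)=1-|\mathcal{A}_{uv}||\mathcal{A}_{vu}|t^2$ if $u\neq v$ (this equals $\det(I+tJ(u,v))$). -}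

module Defs where

open import Level using (Level; _⊔_) renaming (suc to lsuc)
open import Algebra.Bundles using (CommutativeRing)
open import Data.Nat using (ℕ; zero; suc)
open import Data.Fin using (Fin; zero; suc; punchIn; _≟_)
open import Data.Bool using (Bool; true; false; if_then_else_; _∧_; _∨_; not)
open import Relation.Nullary using (¬_)
open import Relation.Nullary.Decidable using (⌊_⌋)
open import Relation.Binary using (Rel; IsDecTotalOrder)
open import Relation.Binary.PropositionalEquality using (_≡_)

record Field (c ℓ : Level) : Set (lsuc (c ⊔ ℓ)) where
  field
    commutativeRing : CommutativeRing c ℓ
  open CommutativeRing commutativeRing public
  infix 8 _⁻¹
  field
    _⁻¹        : Carrier → Carrier
    ⁻¹-cong    : ∀ {x y} → x ≈ y → x ⁻¹ ≈ y ⁻¹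
    ⁻¹-inverse : ∀ x → ¬ (x ≈ 0#) → x * x ⁻¹ ≈ 1#
    0≉1        : ¬ (0# ≈ 1#)

record Digraph : Set where
  field
    nV nA : ℕ
    tl hd : Fin nA → Fin nV

anyFin : ∀ {k} → (Fin k → Bool) → Bool
anyFin {zero}  p = false
anyFin {suc k} p = p zero ∨ anyFin (λ i → p (suc i))

module FieldOps {c ℓ} (K : Field c ℓ) where
  open Field K using (Carrier; _+_; _*_; -_; 0#; 1#)

  Σ : ∀ {k} → (Fin k → Carrier) → Carrier
  Σ {zero}  f = 0#
  Σ {suc k} f = f zero + Σ (λ i → f (suc i))

  Π : ∀ {k} → (Fin k → Carrier) → Carrier
  Π {zero}  f = 1#
  Π {suc k} f = f zero * Π (λ i → f (suc i))

  [_] : Bool → Carrier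
  [ b ] = if b then 1# else 0#

  δ : ∀ {k} → Fin k → Fin k → Carrier
  δ x y = [ ⌊ x ≟ y ⌋ ]

  sgn : ∀ {k} → Fin k → Carrier
  sgn zero    = 1#
  sgn (suc j) = - sgn j

  det : ∀ {k} → (Fin k → Fin k → Carrier) → Carrier
  det {zero}  M = 1#
  det {suc k} M = Σ (λ j → sgn j * M zero j * det (λ i l → M (suc i) (punchIn j l)))

module Construction {c ℓ r} (K : Field c ℓ) (Δ : Digraph)
    (τ₁ τ₂ : Fin (Digraph.nA Δ) → Field.Carrier K)
    (_≼_ : Rel (Fin (Digraph.nV Δ)) r) (≼-dto : IsDecTotalOrder _≡_ _≼_)
    (t : Field.Carrier K) where
  open Field K using (Carrier; _+_; _*_; -_; _-_; 0#; 1#; _⁻¹)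
  open FieldOps K
  open Digraph Δ
  open IsDecTotalOrder ≼-dto using (_≤?_)

  V = Fin nV
  Arc = Fin nA

  inA : V → V → Arc → Bool
  inA u v a = ⌊ tl a ≟ u ⌋ ∧ ⌊ hd a ≟ v ⌋

  -- a ∈ 𝒜(u,v) = 𝒜_uv ∪ 𝒜_vu
  inA² : V → V → Arc → Bool
  inA² u v a = inA u v a ∨ inA v u a

  -- a' is an inverse of a  (a' ∈ 𝒜_{h(a) t(a)})
  isInv : Arc → Arc → Bool
  isInv a a' = inA (hd a) (tl a) a'

  card : V → V → Carrier
  card u v = Σ (λ a → [ inA u v a ])

  inΦ : V → V → Bool
  inΦ u v = ⌊ u ≤? v ⌋ ∧ anyFin (inA² u v)

  f : V → V → Carrier
  f u v = if ⌊ u ≟ v ⌋ then 1# + card u u * t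
          else 1# - card u v * card v u * (t * t)

  -- entries of J(u,v), K(u,v), L(u,v) (for arcs in 𝒜(u,v))
  Jₑ : Arc → Arc → Carrier
  Jₑ a a' = [ isInv a a' ]

  Kₑ : Arc → V → Carrier
  Kₑ a w = τ₁ a * δ (hd a) w

  Lₑ : V → Arc → Carrier
  Lₑ w a' = τ₂ a' * δ w (tl a')

  LK : V → V → V → V → Carrier
  LK u v w w' = Σ (λ a → [ inA² u v a ] * (Lₑ w a * Kₑ a w'))

  LJK : V → V → V → V → Carrier
  LJK u v w w' = Σ (λ a → Σ (λ a' →
    [ inA² u v a ] * [ inA² u v a' ] * (Lₑ w a * Jₑ a a' * Kₑ a' w')))

  LJJK : V → V → V → V → Carrier
  LJJK u v w w' = Σ (λ a → Σ (λ a'' → Σ (λ a' →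
    [ inA² u v a ] * [ inA² u v a'' ] * [ inA² u v a' ] *
    (Lₑ w a * Jₑ a a'' * Jₑ a'' a' * Kₑ a' w'))))

  Aθ : V → V → Carrier
  Aθ w w' = Σ (λ u → Σ (λ v → [ inΦ u v ] * LK u v w w'))

  Dθ : V → V → Carrier
  Dθ w w' = Σ (λ u → Σ (λ v → [ inΦ u v ] * (LJK u v w w' * (f u v) ⁻¹)))

  Xθ : V → V → Carrier
  Xθ w w' = Σ (λ u → Σ (λ v →
    [ inΦ u v ∧ not ⌊ u ≟ v ⌋ ] * (LJJK u v w w' * (f u v) ⁻¹)))

  Mθ : Arc → Arc → Carrier
  Mθ a a' = τ₁ a * τ₂ a' * δ (hd a) (tl a') - [ isInv a a' ]

  LHS : Carrier
  LHS = det (λ a a' → δ a a' - t * Mθ a a')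

  RHS : Carrier
  RHS = Π (λ u → Π (λ v → if inΦ u v then f u v else 1#)) *
        det (λ w w' → δ w w' - t * Aθ w w' + t * t * Dθ w w'
                      - t * t * t * Xθ w w')

{-# OPTIONS --safe #-}
-- Write M_θ = K L - J, where K = (τ₁(a) δ_{h(a) w}) is 𝒜 × V, L = (τ₂(a) δ_{w t(a)}) is V × 𝒜 and
-- J is the inverse-relation matrix of the arcs.  Then I - tM_θ = (I + tJ) - (tK) L is a Schur complement
-- in the bordered matrix [[I + tJ, tK], [L, I]], whose determinant is also det (I + tJ) times the other
-- Schur complement I - L (I + tJ)⁻¹ tK.  J is block diagonal for the partition of the arcs into the sets
-- 𝒜(u,v), (u,v) ∈ Φ_Δ, and on each block J³ = |𝒜uv||𝒜vu| J (J² = |𝒜uu| J at a loop).  This gives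
-- (I + tJ)⁻¹ in closed form, turns L (I + tJ)⁻¹ tK into tA - t²D + t³X, and yields det (I + tJ) = Π f(u,v):
-- factor J = 𝒫𝒬 so that 𝒬𝒫 is block diagonal with 2 × 2 blocks, and use det (I + t𝒫𝒬) = det (I + t𝒬𝒫).

module Submission where

open import Defs
open import Algebra.Bundles using (CommutativeRing)
open import Algebra.Solver.Ring.AlmostCommutativeRing using (fromCommutativeRing; _-Raw-AlmostCommutative⟶_)
open import Data.Bool using (Bool; true; false; if_then_else_; not; _∧_; _∨_)
open import Data.Bool.Properties using (∨-zeroʳ; ∧-conicalˡ; ∧-conicalʳ; ∧-zeroʳ; ∧-comm; ∨-comm)
open import Data.Empty using (⊥)
open import Data.Fin using (Fin; zero; suc; _≟_; toℕ; inject₁; fromℕ<; punchIn; punchOut; _↑ˡ_; _↑ʳ_; splitAt; combine; remQuot)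
open import Data.Fin.Properties
  using (toℕ-inject₁; toℕ-injective; toℕ-fromℕ<; toℕ<n; punchInᵢ≢i; punchIn-injective; punchIn-punchOut;
         splitAt-↑ˡ; splitAt-↑ʳ; splitAt⁻¹-↑ˡ; splitAt⁻¹-↑ʳ; combine-remQuot; remQuot-combine; combine-injective)
open import Data.Integer as ℤ using (ℤ; +_; -[1+_]; _⊖_)
import Data.Integer.Properties as ℤP
open import Data.Maybe using (Maybe; just; nothing)
open import Data.Nat as ℕ using (ℕ; zero; suc)
import Data.Nat.Properties as ℕP
open import Data.Product using (_×_; _,_; proj₁; proj₂; ∃-syntax; map₂)
open import Data.Sign as Sign using (Sign)
open import Data.Sum using (_⊎_; inj₁; inj₂; [_,_]′)
open import Function using (_∘_; _$_; const)
open import Relation.Binary using (Rel; IsDecTotalOrder)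
open import Relation.Binary.Definitions using (tri<; tri≈; tri>)
open import Relation.Binary.PropositionalEquality as P using (_≡_; _≢_)
open import Relation.Nullary using (Dec; yes; no; ¬_; contradiction)
open import Relation.Nullary.Decidable using (⌊_⌋)
open import Relation.Nullary.Reflects using (ofʸ; ofⁿ)

-- The ring solver needs coefficients with a (weakly) decidable equality; integer coefficients are
-- interpreted through the canonical homomorphism ℤ → R.
module IntegerCoefficients {c ℓ} (R : CommutativeRing c ℓ) where
  open CommutativeRing R
  open import Algebra.Properties.Semiring.Mult.TCOptimised semiring using (×1-homo-*) renaming (_×_ to _×′_)
  open import Algebra.Properties.Monoid.Mult.TCOptimised +-monoid using (×-homo-+; 1+×)
  open import Algebra.Properties.Ring ring
    using (-‿involutive; -‿distribˡ-*; -‿distribʳ-*; -‿+-comm; -0#≈0#)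
  open import Relation.Binary.Reasoning.Setoid setoid

  ι : ℤ → Carrier
  ι (+ n)    = n ×′ 1#
  ι -[1+ n ] = - (suc n ×′ 1#)

  private
    sign : Sign → Carrier
    sign Sign.+ = 1#
    sign Sign.- = - 1#

    sign-* : ∀ s s′ → sign (s Sign.* s′) ≈ sign s * sign s′
    sign-* Sign.+ Sign.+ = sym (*-identityˡ _)
    sign-* Sign.+ Sign.- = sym (*-identityˡ _)
    sign-* Sign.- Sign.+ = sym (*-identityʳ _)
    sign-* Sign.- Sign.- = begin
      1#              ≈⟨ sym (-‿involutive _) ⟩
      - - 1#          ≈⟨ -‿cong (sym (*-identityʳ _)) ⟩
      - (- 1# * 1#)   ≈⟨ -‿distribʳ-* _ _ ⟩
      - 1# * - 1#     ∎

    ι-◃ : ∀ s n → ι (s ℤ.◃ n) ≈ sign s * (n ×′ 1#)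
    ι-◃ s       zero    = sym (zeroʳ _)
    ι-◃ Sign.+ (suc n) = sym (*-identityˡ _)
    ι-◃ Sign.- (suc n) = trans (-‿cong (sym (*-identityˡ _))) (-‿distribˡ-* _ _)

    ι-signAbs : ∀ i → ι i ≈ sign (ℤ.sign i) * (ℤ.∣ i ∣ ×′ 1#)
    ι-signAbs i = trans (reflexive (P.cong ι (P.sym (ℤP.◃-inverse i)))) (ι-◃ (ℤ.sign i) ℤ.∣ i ∣)

    interchange : ∀ a b x y → (a * b) * (x * y) ≈ (a * x) * (b * y)
    interchange a b x y = begin
      (a * b) * (x * y) ≈⟨ *-assoc _ _ _ ⟩
      a * (b * (x * y)) ≈⟨ *-congˡ (trans (sym (*-assoc _ _ _)) (*-congʳ (*-comm _ _))) ⟩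
      a * ((x * b) * y) ≈⟨ *-congˡ (*-assoc _ _ _) ⟩
      a * (x * (b * y)) ≈⟨ sym (*-assoc _ _ _) ⟩
      (a * x) * (b * y) ∎

    ι-⊖ : ∀ m n → ι (m ⊖ n) ≈ m ×′ 1# - n ×′ 1#
    ι-⊖ zero    zero    = sym (-‿inverseʳ _)
    ι-⊖ zero    (suc n) = sym (+-identityˡ _)
    ι-⊖ (suc m) zero    = sym (trans (+-congˡ -0#≈0#) (+-identityʳ _))
    ι-⊖ (suc m) (suc n) = begin
      ι (suc m ⊖ suc n)                      ≡⟨ P.cong ι (ℤP.[1+m]⊖[1+n]≡m⊖n m n) ⟩
      ι (m ⊖ n)                              ≈⟨ ι-⊖ m n ⟩
      x + - y                                ≈⟨ sym (+-congʳ (+-identityˡ _)) ⟩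
      (0# + x) + - y                         ≈⟨ +-congʳ (+-congʳ (sym (-‿inverseʳ 1#))) ⟩
      ((1# + - 1#) + x) + - y                ≈⟨ +-congʳ (+-assoc _ _ _) ⟩
      (1# + (- 1# + x)) + - y                ≈⟨ +-congʳ (+-congˡ (+-comm _ _)) ⟩
      (1# + (x + - 1#)) + - y                ≈⟨ +-congʳ (sym (+-assoc _ _ _)) ⟩
      ((1# + x) + - 1#) + - y                ≈⟨ +-assoc _ _ _ ⟩
      (1# + x) + (- 1# + - y)                ≈⟨ +-congˡ (-‿+-comm _ _) ⟩
      (1# + x) - (1# + y)                    ≈⟨ sym (+-cong (1+× m 1#) (-‿cong (1+× n 1#))) ⟩
      suc m ×′ 1# - suc n ×′ 1#              ∎
      where
      x = m ×′ 1#
      y = n ×′ 1#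

  ι-+ : ∀ i j → ι (i ℤ.+ j) ≈ ι i + ι j
  ι-+ -[1+ m ] -[1+ n ] = begin
    - (suc (suc (m ℕ.+ n)) ×′ 1#)                ≈⟨ -‿cong (trans (1+× (suc m ℕ.+ n) 1#) (+-congˡ (×-homo-+ 1# (suc m) n))) ⟩
    - (1# + (suc m ×′ 1# + n ×′ 1#))             ≈⟨ -‿cong (trans (sym (+-assoc _ _ _))
                                                    (trans (+-congʳ (+-comm _ _)) (+-assoc _ _ _))) ⟩
    - (suc m ×′ 1# + (1# + n ×′ 1#))             ≈⟨ -‿cong (+-congˡ (sym (1+× n 1#))) ⟩
    - (suc m ×′ 1# + suc n ×′ 1#)                ≈⟨ sym (-‿+-comm _ _) ⟩
    - (suc m ×′ 1#) + - (suc n ×′ 1#)            ∎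
  ι-+ -[1+ m ] (+ n)    = trans (ι-⊖ n (suc m)) (+-comm _ _)
  ι-+ (+ m)    -[1+ n ] = ι-⊖ m (suc n)
  ι-+ (+ m)    (+ n)    = ×-homo-+ 1# m n

  ι-* : ∀ i j → ι (i ℤ.* j) ≈ ι i * ι j
  ι-* i j = begin
    ι (ℤ.sign i Sign.* ℤ.sign j ℤ.◃ ℤ.∣ i ∣ ℕ.* ℤ.∣ j ∣)
      ≈⟨ ι-◃ (ℤ.sign i Sign.* ℤ.sign j) (ℤ.∣ i ∣ ℕ.* ℤ.∣ j ∣) ⟩
    sign (ℤ.sign i Sign.* ℤ.sign j) * ((ℤ.∣ i ∣ ℕ.* ℤ.∣ j ∣) ×′ 1#)
      ≈⟨ *-cong (sign-* (ℤ.sign i) (ℤ.sign j)) (×1-homo-* ℤ.∣ i ∣ ℤ.∣ j ∣) ⟩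
    (sign (ℤ.sign i) * sign (ℤ.sign j)) * ((ℤ.∣ i ∣ ×′ 1#) * (ℤ.∣ j ∣ ×′ 1#))
      ≈⟨ interchange _ _ _ _ ⟩
    (sign (ℤ.sign i) * (ℤ.∣ i ∣ ×′ 1#)) * (sign (ℤ.sign j) * (ℤ.∣ j ∣ ×′ 1#))
      ≈⟨ sym (*-cong (ι-signAbs i) (ι-signAbs j)) ⟩
    ι i * ι j ∎

  ι-neg : ∀ i → ι (ℤ.- i) ≈ - ι i
  ι-neg (+ zero)  = sym -0#≈0#
  ι-neg (+ suc n) = refl
  ι-neg -[1+ n ]  = sym (-‿involutive _)

  ℤ-homomorphism : ℤ.+-*-rawRing -Raw-AlmostCommutative⟶ fromCommutativeRing R
  ℤ-homomorphism = record
    { ⟦_⟧ = ι ; +-homo = ι-+ ; *-homo = ι-* ; -‿homo = ι-neg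
    ; 0-homo = refl ; 1-homo = refl }

  ι-≟ : ∀ i j → Maybe (ι i ≈ ι j)
  ι-≟ i j with i ℤ.≟ j
  ... | yes i≡j = just (reflexive (P.cong ι i≡j))
  ... | no _    = nothing

  open import Algebra.Solver.Ring ℤ.+-*-rawRing (fromCommutativeRing R) ℤ-homomorphism ι-≟ public

module Booleans where
  ≟-diag : ∀ {n} {i j : Fin n} → i ≡ j → ⌊ i ≟ j ⌋ ≡ true
  ≟-diag {i = i} P.refl with i ≟ i
  ... | yes _   = P.refl
  ... | no  i≢i = contradiction P.refl i≢i

  ≟-≢ : ∀ {n} {i j : Fin n} → i ≢ j → ⌊ i ≟ j ⌋ ≡ false
  ≟-≢ {i = i} {j} i≢j with i ≟ j
  ... | yes i≡j = contradiction i≡j i≢j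
  ... | no  _   = P.refl

  ≟-sound : ∀ {n} {i j : Fin n} → ⌊ i ≟ j ⌋ ≡ true → i ≡ j
  ≟-sound {i = i} {j} eq with i ≟ j
  ... | yes i≡j = i≡j

  ≟-sym : ∀ {n} (i j : Fin n) → ⌊ i ≟ j ⌋ ≡ ⌊ j ≟ i ⌋
  ≟-sym i j with i ≟ j
  ... | yes i≡j = P.sym (≟-diag (P.sym i≡j))
  ... | no  i≢j = P.sym (≟-≢ (i≢j ∘ P.sym))

  ∧-intro : ∀ {a b} → a ≡ true → b ≡ true → a ∧ b ≡ true
  ∧-intro P.refl P.refl = P.refl

  ∨-introˡ : ∀ {a b} → a ≡ true → a ∨ b ≡ true
  ∨-introˡ P.refl = P.refl

  ∨-introʳ : ∀ {a b} → b ≡ true → a ∨ b ≡ true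
  ∨-introʳ {a} P.refl = ∨-zeroʳ a

  ∨-elim : ∀ {a b} → a ∨ b ≡ true → a ≡ true ⊎ b ≡ true
  ∨-elim {true}  _ = inj₁ P.refl
  ∨-elim {false} b = inj₂ b

  Bool-ext : ∀ {a b} → (a ≡ true → b ≡ true) → (b ≡ true → a ≡ true) → a ≡ b
  Bool-ext {true}  a⇒b _ = P.sym (a⇒b P.refl)
  Bool-ext {false} {true}  _ b⇒a = b⇒a P.refl
  Bool-ext {false} {false} _ _   = P.refl

  anyFin-intro : ∀ {k} (p : Fin k → Bool) i → p i ≡ true → anyFin p ≡ true
  anyFin-intro p zero    pᵢ = ∨-introˡ pᵢ
  anyFin-intro p (suc i) pᵢ = ∨-introʳ (anyFin-intro (λ j → p (suc j)) i pᵢ)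

open Booleans

module Sums {c ℓ} (K : Field c ℓ) where
  open Field K hiding (zero)
  open FieldOps K
  open import Algebra.Properties.Ring ring using (-0#≈0#; -‿+-comm)
  open IntegerCoefficients commutativeRing public
  open import Relation.Binary.Reasoning.Setoid setoid public

  Σ-cong : ∀ {n} {f g : Fin n → Carrier} → (∀ i → f i ≈ g i) → Σ f ≈ Σ g
  Σ-cong {zero}  f≈g = refl
  Σ-cong {suc n} f≈g = +-cong (f≈g zero) (Σ-cong (λ i → f≈g (suc i)))

  Π-cong : ∀ {n} {f g : Fin n → Carrier} → (∀ i → f i ≈ g i) → Π f ≈ Π g
  Π-cong {zero}  f≈g = refl
  Π-cong {suc n} f≈g = *-cong (f≈g zero) (Π-cong (λ i → f≈g (suc i)))

  Σ-zero : ∀ {n} {f : Fin n → Carrier} → (∀ i → f i ≈ 0#) → Σ f ≈ 0#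
  Σ-zero {zero}  f≈0 = refl
  Σ-zero {suc n} f≈0 = trans (+-cong (f≈0 zero) (Σ-zero (λ i → f≈0 (suc i)))) (+-identityˡ 0#)

  Σ-+ : ∀ {n} (f g : Fin n → Carrier) → Σ (λ i → f i + g i) ≈ Σ f + Σ g
  Σ-+ {zero}  f g = sym (+-identityˡ 0#)
  Σ-+ {suc n} f g = trans (+-congˡ (Σ-+ (λ i → f (suc i)) (λ i → g (suc i))))
    (solve 4 (λ a b x y → (a :+ b) :+ (x :+ y) := (a :+ x) :+ (b :+ y)) refl _ _ _ _)

  Σ-distribˡ : ∀ {n} (a : Carrier) (f : Fin n → Carrier) → a * Σ f ≈ Σ (λ i → a * f i)
  Σ-distribˡ {zero}  a f = zeroʳ a
  Σ-distribˡ {suc n} a f = trans (distribˡ a _ _) (+-congˡ (Σ-distribˡ a (λ i → f (suc i))))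

  Σ-distribʳ : ∀ {n} (a : Carrier) (f : Fin n → Carrier) → Σ f * a ≈ Σ (λ i → f i * a)
  Σ-distribʳ {zero}  a f = zeroˡ a
  Σ-distribʳ {suc n} a f = trans (distribʳ a _ _) (+-congˡ (Σ-distribʳ a (λ i → f (suc i))))

  Σ-neg : ∀ {n} (f : Fin n → Carrier) → - Σ f ≈ Σ (λ i → - f i)
  Σ-neg {zero}  f = -0#≈0#
  Σ-neg {suc n} f = trans (sym (-‿+-comm _ _)) (+-congˡ (Σ-neg (λ i → f (suc i))))

  Σ-combination : ∀ {n} (α β γ : Carrier) (p q r : Fin n → Carrier) →
    Σ (λ i → α * p i - β * q i + γ * r i) ≈ α * Σ p - β * Σ q + γ * Σ r
  Σ-combination {zero}  α β γ p q r =
    solve 3 (λ α β γ → con (+ 0) := α :* con (+ 0) :- β :* con (+ 0) :+ γ :* con (+ 0)) refl α β γ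
  Σ-combination {suc n} α β γ p q r =
    trans (+-congˡ (Σ-combination α β γ (λ i → p (suc i)) (λ i → q (suc i)) (λ i → r (suc i))))
      (solve 9 (λ α β γ p₀ q₀ r₀ P Q R → α :* p₀ :- β :* q₀ :+ γ :* r₀ :+ (α :* P :- β :* Q :+ γ :* R)
                  := α :* (p₀ :+ P) :- β :* (q₀ :+ Q) :+ γ :* (r₀ :+ R))
             refl α β γ (p zero) (q zero) (r zero) (Σ (λ i → p (suc i))) (Σ (λ i → q (suc i))) (Σ (λ i → r (suc i))))

  *-assoc² : ∀ a b e i → a * b * e * i ≈ a * (b * (e * i))
  *-assoc² a b e i = trans (*-assoc _ _ _) (*-assoc _ _ _)

  Σ-comm : ∀ {n m} (f : Fin n → Fin m → Carrier) →
           Σ (λ i → Σ (λ j → f i j)) ≈ Σ (λ j → Σ (λ i → f i j))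
  Σ-comm {zero} {m} f = sym (Σ-zero {m} (λ _ → refl))
  Σ-comm {suc n}     f = trans (+-congˡ (Σ-comm (λ i → f (suc i))))
                           (sym (Σ-+ (f zero) (λ j → Σ (λ i → f (suc i) j))))

  Σ²-interchange : ∀ {n m k} (h : Fin n → Fin m → Carrier) (X : Fin k → Fin n → Fin m → Carrier) →
    Σ (λ u → Σ (λ v → h u v * Σ (λ a → X a u v))) ≈ Σ (λ a → Σ (λ u → Σ (λ v → h u v * X a u v)))
  Σ²-interchange {n} {m} h X = begin
    Σ (λ u → Σ (λ v → h u v * Σ (λ a → X a u v)))   ≈⟨ Σ-cong {n} (λ u → Σ-cong {m} λ v → Σ-distribˡ (h u v) (λ a → X a u v)) ⟩
    Σ (λ u → Σ (λ v → Σ (λ a → h u v * X a u v)))   ≈⟨ Σ-cong {n} (λ u → Σ-comm (λ v a → h u v * X a u v)) ⟩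
    Σ (λ u → Σ (λ a → Σ (λ v → h u v * X a u v)))   ≈⟨ Σ-comm (λ u a → Σ (λ v → h u v * X a u v)) ⟩
    Σ (λ a → Σ (λ u → Σ (λ v → h u v * X a u v)))   ∎

  Σ-splitAt : ∀ {n m} (f : Fin (n ℕ.+ m) → Carrier) →
              Σ f ≈ Σ (λ i → f (i ↑ˡ m)) + Σ (λ j → f (n ↑ʳ j))
  Σ-splitAt {zero}      f = sym (+-identityˡ _)
  Σ-splitAt {suc n} {m} f = trans (+-congˡ (Σ-splitAt {n} {m} (λ i → f (suc i)))) (sym (+-assoc _ _ _))

  Σ-combine : ∀ {n m} (f : Fin (n ℕ.* m) → Carrier) →
              Σ f ≈ Σ {n} (λ i → Σ {m} (λ j → f (combine i j)))
  Σ-combine {zero}      f = refl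
  Σ-combine {suc n} {m} f = trans (Σ-splitAt {m} f) (+-congˡ (Σ-combine {n} (λ x → f (m ↑ʳ x))))

  []-∧ : ∀ a b → [ a ∧ b ] ≈ [ a ] * [ b ]
  []-∧ true  b = sym (*-identityˡ _)
  []-∧ false b = sym (zeroˡ _)

  []-idem : ∀ b → [ b ] * [ b ] ≈ [ b ]
  []-idem true  = *-identityˡ _
  []-idem false = zeroˡ _

  []-true : ∀ {b} → b ≡ true → [ b ] ≈ 1#
  []-true P.refl = refl

  []-false : ∀ {b} → b ≡ false → [ b ] ≈ 0#
  []-false P.refl = refl

  []-conjunction-zero : ∀ a b c d → (a ≡ true → b ≡ true → c ≡ true → d ≡ true → ⊥) →
                        [ a ] * [ b ] * ([ c ] * [ d ]) ≈ 0#
  []-conjunction-zero true  true  true  true  ¬all = contradiction P.refl (λ r → ¬all r r r r)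
  []-conjunction-zero false b     c     d     _    = trans (*-congʳ (zeroˡ _)) (zeroˡ _)
  []-conjunction-zero true  false c     d     _    = trans (*-congʳ (zeroʳ _)) (zeroˡ _)
  []-conjunction-zero true  true  false d     _    = trans (*-congˡ (zeroˡ _)) (zeroʳ _)
  []-conjunction-zero true  true  true  false _    = trans (*-congˡ (zeroʳ _)) (zeroʳ _)

  []-*-cases : ∀ {r} {R : Set r} a b → (a ≡ true → b ≡ true → R) → [ a ] * [ b ] ≈ 0# ⊎ R
  []-*-cases true  true  both = inj₂ (both P.refl P.refl)
  []-*-cases false b     _    = inj₁ (zeroˡ _)
  []-*-cases true  false _    = inj₁ (zeroʳ _)

  []-+-exclusive : ∀ a b → (a ≡ true → b ≡ false) → (a ≡ false → b ≡ true) → [ a ] + [ b ] ≈ 1#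
  []-+-exclusive true  false _ _ = +-identityʳ _
  []-+-exclusive false true  _ _ = +-identityˡ _
  []-+-exclusive true  true  a⇒¬b _ = contradiction (a⇒¬b P.refl) λ ()
  []-+-exclusive false false _ ¬a⇒b = contradiction (¬a⇒b P.refl) λ ()

  δ-≡ : ∀ {n} {i j : Fin n} → i ≡ j → δ i j ≈ 1#
  δ-≡ i≡j = reflexive (P.cong [_] (≟-diag i≡j))

  δ-refl : ∀ {n} (i : Fin n) → δ i i ≈ 1#
  δ-refl i = δ-≡ P.refl

  δ-≢ : ∀ {n} {i j : Fin n} → i ≢ j → δ i j ≈ 0#
  δ-≢ i≢j = reflexive (P.cong [_] (≟-≢ i≢j))

  δ-sym : ∀ {n} (i j : Fin n) → δ i j ≈ δ j i
  δ-sym i j = reflexive (P.cong [_] (≟-sym i j))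

  δ-suc : ∀ {n} (i j : Fin n) → δ (suc i) (suc j) ≈ δ i j
  δ-suc i j with i ≟ j
  ... | yes _ = refl
  ... | no  _ = refl

  δ-combine : ∀ {n m} (i i′ : Fin n) (j j′ : Fin m) → δ (combine i j) (combine i′ j′) ≈ δ i i′ * δ j j′
  δ-combine i i′ j j′ = byCases (i ≟ i′) (j ≟ j′)
    where
    byCases : Dec (i ≡ i′) → Dec (j ≡ j′) → δ (combine i j) (combine i′ j′) ≈ δ i i′ * δ j j′
    byCases (yes i≡i′) (yes j≡j′) = trans (δ-≡ (P.cong₂ combine i≡i′ j≡j′))
                                          (sym (trans (*-cong (δ-≡ i≡i′) (δ-≡ j≡j′)) (*-identityˡ _)))
    byCases (no i≢i′) _           = trans (δ-≢ (i≢i′ ∘ proj₁ ∘ combine-injective i j i′ j′))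
                                          (sym (trans (*-congʳ (δ-≢ i≢i′)) (zeroˡ _)))
    byCases (yes _) (no j≢j′)     = trans (δ-≢ (j≢j′ ∘ proj₂ ∘ combine-injective i j i′ j′))
                                          (sym (trans (*-congˡ (δ-≢ j≢j′)) (zeroʳ _)))

  Σ-δˡ : ∀ {n} (i : Fin n) (f : Fin n → Carrier) → Σ (λ j → δ i j * f j) ≈ f i
  Σ-δˡ {suc n} zero f = begin
    δ {suc n} zero zero * f zero + Σ (λ j → δ {suc n} zero (suc j) * f (suc j))
      ≈⟨ +-cong (*-congʳ (δ-refl {suc n} zero))
                (Σ-zero {n} (λ j → trans (*-congʳ (δ-≢ {suc n} {zero} {suc j} λ ())) (zeroˡ _))) ⟩
    1# * f zero + 0#  ≈⟨ trans (+-identityʳ _) (*-identityˡ _) ⟩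
    f zero            ∎
  Σ-δˡ {suc n} (suc i) f = begin
    δ (suc i) zero * f zero + Σ (λ j → δ (suc i) (suc j) * f (suc j))
      ≈⟨ +-cong (trans (*-congʳ (δ-≢ {suc n} {suc i} {zero} λ ())) (zeroˡ _)) (Σ-cong {n} (λ j → *-congʳ (δ-suc i j))) ⟩
    0# + Σ (λ j → δ i j * f (suc j))  ≈⟨ trans (+-identityˡ _) (Σ-δˡ i (λ j → f (suc j))) ⟩
    f (suc i)                         ∎

  Σ-δ² : ∀ {n m} (i : Fin n) (j : Fin m) (g : Fin n → Fin m → Carrier) →
         Σ (λ u → Σ (λ v → δ i u * δ j v * g u v)) ≈ g i j
  Σ-δ² {n} {m} i j g = begin
    Σ (λ u → Σ (λ v → δ i u * δ j v * g u v))  ≈⟨ Σ-cong {n} (λ u → trans (Σ-cong {m} λ v → *-assoc _ _ _)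
                                                                   (sym (Σ-distribˡ (δ i u) (λ v → δ j v * g u v)))) ⟩
    Σ (λ u → δ i u * Σ (λ v → δ j v * g u v))  ≈⟨ Σ-δˡ i _ ⟩
    Σ (λ v → δ j v * g i v)                    ≈⟨ Σ-δˡ j (g i) ⟩
    g i j                                      ∎

  Σ-δʳ : ∀ {n} (i : Fin n) (f : Fin n → Carrier) → Σ (λ j → f j * δ j i) ≈ f i
  Σ-δʳ {n} i f = trans (Σ-cong {n} (λ j → trans (*-comm _ _) (*-congʳ (δ-sym j i)))) (Σ-δˡ i f)

  Σ-pair : ∀ {n} (f : Fin n → Carrier) {p q : Fin n} → p ≢ q →
           (∀ j → j ≢ p → j ≢ q → f j ≈ 0#) → Σ f ≈ f p + f q
  Σ-pair {n} f {p} {q} p≢q vanish = begin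
    Σ f                                          ≈⟨ Σ-cong split ⟩
    Σ (λ j → δ p j * f p + δ q j * f q)          ≈⟨ Σ-+ {n} _ _ ⟩
    Σ (λ j → δ p j * f p) + Σ (λ j → δ q j * f q) ≈⟨ +-cong (Σ-δˡ p (λ _ → f p)) (Σ-δˡ q (λ _ → f q)) ⟩
    f p + f q                                    ∎
    where
    split : ∀ j → f j ≈ δ p j * f p + δ q j * f q
    split j with j ≟ p | j ≟ q
    ... | yes P.refl | _ = sym (trans (+-cong (*-congʳ (δ-refl j)) (*-congʳ (δ-≢ (p≢q ∘ P.sym))))
                                      (trans (+-cong (*-identityˡ _) (zeroˡ _)) (+-identityʳ _)))
    ... | no j≢p | yes P.refl = sym (trans (+-cong (*-congʳ (δ-≢ p≢q)) (*-congʳ (δ-refl j)))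
                                          (trans (+-cong (zeroˡ _) (*-identityˡ _)) (+-identityˡ _)))
    ... | no j≢p | no j≢q = trans (vanish j j≢p j≢q)
      (sym (trans (+-cong (*-congʳ (δ-≢ (j≢p ∘ P.sym))) (*-congʳ (δ-≢ (j≢q ∘ P.sym))))
                  (trans (+-cong (zeroˡ _) (zeroˡ _)) (+-identityˡ _))))

module Determinant {c ℓ} (K : Field c ℓ) where
  open Field K hiding (zero)
  open FieldOps K
  open Sums K public
  open import Algebra.Properties.Group +-group using (inverseʳ-unique)
  open import Algebra.Properties.Ring ring using (-‿involutive; -0#≈0#)

  Matrix : ℕ → Set c
  Matrix k = Fin k → Fin k → Carrier

  minor : ∀ {k} → Matrix (suc k) → Fin (suc k) → Matrix k
  minor M j i l = M (suc i) (punchIn j l)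

  det-cong : ∀ {k} {M N : Matrix k} → (∀ i l → M i l ≈ N i l) → det M ≈ det N
  det-cong {zero}  M≈N = refl
  det-cong {suc k} M≈N = Σ-cong {suc k} λ j →
    *-cong (*-congˡ {sgn j} (M≈N zero j)) (det-cong λ i l → M≈N (suc i) (punchIn j l))

  det-zeroRow : ∀ {k} (M : Matrix k) (r : Fin k) → (∀ l → M r l ≈ 0#) → det M ≈ 0#
  det-zeroRow {suc k} M zero    M₀≈0 = Σ-zero {suc k} λ j →
    trans (*-congʳ (trans (*-congˡ (M₀≈0 j)) (zeroʳ (sgn j)))) (zeroˡ (det (minor M j)))
  det-zeroRow {suc k} M (suc r) Mᵣ≈0 = Σ-zero {suc k} λ j →
    trans (*-congˡ (det-zeroRow (minor M j) r (λ l → Mᵣ≈0 (punchIn j l)))) (zeroʳ (sgn j * M zero j))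

  det-linearAt : ∀ {k} (p : Fin k) (a b : Carrier) {M N₁ N₂ : Matrix k} →
    (∀ i l → l ≢ p → M i l ≈ N₁ i l) → (∀ i l → l ≢ p → M i l ≈ N₂ i l) →
    (∀ i → M i p ≈ a * N₁ i p + b * N₂ i p) →
    det M ≈ a * det N₁ + b * det N₂
  det-linearAt {suc k} p a b {M} {N₁} {N₂} M≈N₁ M≈N₂ Mₚ = begin
    det M                                    ≈⟨ Σ-cong {suc k} term ⟩
    Σ (λ j → a * T₁ j + b * T₂ j)            ≈⟨ Σ-+ (λ j → a * T₁ j) (λ j → b * T₂ j) ⟩
    Σ (λ j → a * T₁ j) + Σ (λ j → b * T₂ j)  ≈⟨ sym (+-cong (Σ-distribˡ a T₁) (Σ-distribˡ b T₂)) ⟩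
    a * det N₁ + b * det N₂                  ∎
    where
    T₁ T₂ : Fin (suc k) → Carrier
    T₁ j = sgn j * N₁ zero j * det (minor N₁ j)
    T₂ j = sgn j * N₂ zero j * det (minor N₂ j)
    term : ∀ j → sgn j * M zero j * det (minor M j) ≈ a * T₁ j + b * T₂ j
    term j with j ≟ p
    ... | yes P.refl = begin
      sgn j * M zero j * det (minor M j)
        ≈⟨ *-cong (*-congˡ (Mₚ zero)) (det-cong λ i l → M≈N₁ (suc i) _ (punchInᵢ≢i j l)) ⟩
      sgn j * (a * N₁ zero j + b * N₂ zero j) * D₁
        ≈⟨ solve 6 (λ s a x b y d → s :* (a :* x :+ b :* y) :* d := a :* (s :* x :* d) :+ b :* (s :* y :* d))
                   refl (sgn j) a (N₁ zero j) b (N₂ zero j) D₁ ⟩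
      a * T₁ j + b * (sgn j * N₂ zero j * D₁)
        ≈⟨ +-congˡ (*-congˡ (*-congˡ (det-cong λ i l →
             trans (sym (M≈N₁ (suc i) _ (punchInᵢ≢i j l))) (M≈N₂ (suc i) _ (punchInᵢ≢i j l))))) ⟩
      a * T₁ j + b * T₂ j ∎
      where D₁ = det (minor N₁ j)
    ... | no j≢p = begin
      sgn j * M zero j * det (minor M j)
        ≈⟨ *-congˡ (det-linearAt p′ a b (λ i l l≢p′ → M≈N₁ (suc i) _ (avoids l≢p′))
                                        (λ i l l≢p′ → M≈N₂ (suc i) _ (avoids l≢p′))
                                        (λ i → P.subst (λ z → M (suc i) z ≈ a * N₁ (suc i) z + b * N₂ (suc i) z)
                                                       (P.sym (punchIn-punchOut j≢p)) (Mₚ (suc i)))) ⟩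
      sgn j * M zero j * (a * det (minor N₁ j) + b * det (minor N₂ j))
        ≈⟨ solve 6 (λ s m a d₁ b d₂ → s :* m :* (a :* d₁ :+ b :* d₂) := a :* (s :* m :* d₁) :+ b :* (s :* m :* d₂))
                   refl (sgn j) (M zero j) a (det (minor N₁ j)) b (det (minor N₂ j)) ⟩
      a * (sgn j * M zero j * det (minor N₁ j)) + b * (sgn j * M zero j * det (minor N₂ j))
        ≈⟨ +-cong (*-congˡ (*-congʳ (*-congˡ (M≈N₁ zero j j≢p))))
                  (*-congˡ (*-congʳ (*-congˡ (M≈N₂ zero j j≢p)))) ⟩
      a * T₁ j + b * T₂ j ∎
      where
      p′ = punchOut j≢p
      avoids : ∀ {l} → l ≢ p′ → punchIn j l ≢ p
      avoids l≢p′ e = l≢p′ (punchIn-injective j _ p′ (P.trans e (P.sym (punchIn-punchOut j≢p))))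

  det-additiveAt : ∀ {k} (p : Fin k) {M N₁ N₂ : Matrix k} →
    (∀ i l → l ≢ p → M i l ≈ N₁ i l) → (∀ i l → l ≢ p → M i l ≈ N₂ i l) →
    (∀ i → M i p ≈ N₁ i p + N₂ i p) → det M ≈ det N₁ + det N₂
  det-additiveAt p M≈N₁ M≈N₂ Mₚ =
    trans (det-linearAt p 1# 1# M≈N₁ M≈N₂ (λ i → trans (Mₚ i) (sym (+-cong (*-identityˡ _) (*-identityˡ _)))))
          (+-cong (*-identityˡ _) (*-identityˡ _))

  Adjacent : ∀ {k} → Fin k → Fin k → Set
  Adjacent p q = toℕ q ≡ suc (toℕ p)

  adjacent⇒≢ : ∀ {k} {p q : Fin k} → Adjacent p q → p ≢ q
  adjacent⇒≢ q=1+p P.refl = ℕP.1+n≢n (P.sym q=1+p)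

  sgn-adjacent : ∀ {k} {p q : Fin k} → Adjacent p q → sgn q ≈ - sgn p
  sgn-adjacent {p = zero}  {suc zero} _     = refl
  sgn-adjacent {p = suc p} {suc q}    q=1+p = -‿cong (sgn-adjacent {p = p} {q} (ℕP.suc-injective q=1+p))

  punchIn-adjacent : ∀ {k} {p q : Fin (suc k)} → Adjacent p q → ∀ l →
    punchIn p l ≡ punchIn q l ⊎ (punchIn p l ≡ q × punchIn q l ≡ p)
  punchIn-adjacent {p = zero}  {suc zero} _ zero    = inj₂ (P.refl , P.refl)
  punchIn-adjacent {p = zero}  {suc zero} _ (suc l) = inj₁ P.refl
  punchIn-adjacent {suc k} {suc p} {suc q} _ zero = inj₁ P.refl
  punchIn-adjacent {suc k} {suc p} {suc q} q=1+p (suc l)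
    with punchIn-adjacent {p = p} {q} (ℕP.suc-injective q=1+p) l
  ... | inj₁ same         = inj₁ (P.cong suc same)
  ... | inj₂ (e₁ , e₂)    = inj₂ (P.cong suc e₁ , P.cong suc e₂)

  punchOut-adjacent : ∀ {k} {j p q : Fin (suc k)} (j≢p : j ≢ p) (j≢q : j ≢ q) →
    Adjacent p q → Adjacent (punchOut j≢p) (punchOut j≢q)
  punchOut-adjacent {k}     {zero}  {zero}  {_}     j≢p _ _ = contradiction P.refl j≢p
  punchOut-adjacent {k}     {zero}  {suc p} {suc q} _ _ q=1+p = ℕP.suc-injective q=1+p
  punchOut-adjacent {suc k} {suc zero}    {zero} {suc zero} _ j≢q _ = contradiction P.refl j≢q
  punchOut-adjacent {suc (suc k)} {suc (suc j)} {zero} {suc zero} _ _ _ = P.refl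
  punchOut-adjacent {suc k} {suc j} {suc p} {suc q} j≢p j≢q q=1+p =
    P.cong suc (punchOut-adjacent (j≢p ∘ P.cong suc) (j≢q ∘ P.cong suc) (ℕP.suc-injective q=1+p))

  det-equalAdjacentColumns : ∀ {k} (M : Matrix k) {p q : Fin k} → Adjacent p q →
    (∀ i → M i p ≈ M i q) → det M ≈ 0#
  det-equalAdjacentColumns {suc k} M {p} {q} adj Mₚ≈M_q = begin
    det M                                      ≈⟨ Σ-pair T (adjacent⇒≢ adj) others ⟩
    T p + T q                                  ≈⟨ +-congˡ (*-cong (*-cong (sgn-adjacent adj) (sym (Mₚ≈M_q zero)))
                                                                  (det-cong λ i l → sym (sameMinor i l))) ⟩
    sgn p * M zero p * D + - sgn p * M zero p * D
      ≈⟨ solve 3 (λ s m d → s :* m :* d :+ (:- s) :* m :* d := con (+ 0)) refl (sgn p) (M zero p) D ⟩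
    0#                                         ∎
    where
    T : Fin (suc k) → Carrier
    T j = sgn j * M zero j * det (minor M j)
    D = det (minor M p)
    sameMinor : ∀ i l → M (suc i) (punchIn p l) ≈ M (suc i) (punchIn q l)
    sameMinor i l with punchIn-adjacent adj l
    ... | inj₁ same      = reflexive (P.cong (M (suc i)) same)
    ... | inj₂ (e₁ , e₂) = trans (reflexive (P.cong (M (suc i)) e₁))
                                 (trans (sym (Mₚ≈M_q (suc i))) (reflexive (P.cong (M (suc i)) (P.sym e₂))))
    others : ∀ j → j ≢ p → j ≢ q → T j ≈ 0#
    others j j≢p j≢q = trans (*-congˡ (det-equalAdjacentColumns (minor M j) (punchOut-adjacent j≢p j≢q adj) λ i →
      trans (reflexive (P.cong (M (suc i)) (punchIn-punchOut j≢p)))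
            (trans (Mₚ≈M_q (suc i)) (reflexive (P.cong (M (suc i)) (P.sym (punchIn-punchOut j≢q)))))))
      (zeroʳ _)

  column : ∀ {k} → Matrix k → Fin k → Fin k → Carrier
  column M p i = M i p

  setColumn : ∀ {k} → Matrix k → Fin k → (Fin k → Carrier) → Matrix k
  setColumn M p v i l = if ⌊ l ≟ p ⌋ then v i else M i l

  setColumn-at : ∀ {k} (M : Matrix k) p v i → setColumn M p v i p ≡ v i
  setColumn-at M p v i rewrite ≟-diag {i = p} P.refl = P.refl

  setColumn-off : ∀ {k} (M : Matrix k) p v i {l} → l ≢ p → setColumn M p v i l ≡ M i l
  setColumn-off M p v i l≢p rewrite ≟-≢ l≢p = P.refl

  setColumn-agreeOff : ∀ {k} (M : Matrix k) p v w i l → l ≢ p → setColumn M p v i l ≈ setColumn M p w i l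
  setColumn-agreeOff M p v w i l l≢p = reflexive (P.trans (setColumn-off M p v i l≢p) (P.sym (setColumn-off M p w i l≢p)))

  setColumns : ∀ {k} → Matrix k → Fin k → Fin k → (Fin k → Carrier) → (Fin k → Carrier) → Matrix k
  setColumns M p q x y = setColumn (setColumn M p x) q y

  module _ {k} (M : Matrix k) {p q : Fin k} (p≢q : p ≢ q) where
    setColumns-p : ∀ x y i → setColumns M p q x y i p ≡ x i
    setColumns-p x y i = P.trans (setColumn-off (setColumn M p x) q y i p≢q) (setColumn-at M p x i)

    setColumns-q : ∀ x y i → setColumns M p q x y i q ≡ y i
    setColumns-q x y i = setColumn-at (setColumn M p x) q y i

    setColumns-off : ∀ x y i {l} → l ≢ p → l ≢ q → setColumns M p q x y i l ≡ M i l
    setColumns-off x y i l≢p l≢q = P.trans (setColumn-off (setColumn M p x) q y i l≢q) (setColumn-off M p x i l≢p)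

  -- Expanding det S(a+b, a+b) = 0 bilinearly, where S(x, y) puts x in column p and y in column q.
  det-swapAdjacentColumns : ∀ {k} (M : Matrix k) {p q : Fin k} → Adjacent p q →
    det (setColumns M p q (column M q) (column M p)) ≈ - det M
  det-swapAdjacentColumns {k} M {p} {q} adj = inverseʳ-unique _ _ (begin
    det M + det (S colq colp)                ≈⟨ sym (+-cong (+-identityˡ _) (+-identityʳ _)) ⟩
    (0# + det M) + (det (S colq colp) + 0#)  ≈⟨ sym (+-cong (+-cong (alternating colp) (det-cong S≈M))
                                                           (+-congˡ (alternating colq))) ⟩
    (det (S colp colp) + det (S colp colq)) + (det (S colq colp) + det (S colq colq))
                                             ≈⟨ sym (+-cong (additiveˢ colp) (additiveˢ colq)) ⟩
    det (S colp sum) + det (S colq sum)      ≈⟨ sym (additiveᵖ sum) ⟩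
    det (S sum sum)                          ≈⟨ alternating sum ⟩
    0#                                       ∎)
    where
    p≢q = adjacent⇒≢ adj
    colp colq sum : Fin k → Carrier
    colp = column M p
    colq = column M q
    sum i = M i p + M i q
    S = setColumns M p q
    alternating : ∀ x → det (S x x) ≈ 0#
    alternating x = det-equalAdjacentColumns _ adj λ i →
      reflexive (P.trans (setColumns-p M p≢q x x i) (P.sym (setColumns-q M p≢q x x i)))
    S≈M : ∀ i l → S colp colq i l ≈ M i l
    S≈M i l = byCases (l ≟ p) (l ≟ q)
      where
      byCases : Dec (l ≡ p) → Dec (l ≡ q) → S colp colq i l ≈ M i l
      byCases (yes l≡p) _         = reflexive (P.trans (P.cong (S colp colq i) l≡p)
                                                   (P.trans (setColumns-p M p≢q colp colq i) (P.cong (M i) (P.sym l≡p))))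
      byCases (no _)    (yes l≡q) = reflexive (P.trans (P.cong (S colp colq i) l≡q)
                                                   (P.trans (setColumns-q M p≢q colp colq i) (P.cong (M i) (P.sym l≡q))))
      byCases (no l≢p)  (no l≢q)  = reflexive (setColumns-off M p≢q colp colq i l≢p l≢q)
    additiveˢ : ∀ x → det (S x sum) ≈ det (S x colp) + det (S x colq)
    additiveˢ x = det-additiveAt q (setColumn-agreeOff Sₓ q sum colp) (setColumn-agreeOff Sₓ q sum colq)
      (λ i → reflexive (P.trans (setColumns-q M p≢q x sum i)
                                (P.sym (P.cong₂ _+_ (setColumns-q M p≢q x colp i) (setColumns-q M p≢q x colq i)))))
      where Sₓ = setColumn M p x
    additiveᵖ : ∀ y → det (S sum y) ≈ det (S colp y) + det (S colq y)
    additiveᵖ y = det-additiveAt p (λ i l l≢p → reflexive (offp colp i l≢p)) (λ i l l≢p → reflexive (offp colq i l≢p))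
      (λ i → reflexive (P.trans (setColumns-p M p≢q sum y i)
                                (P.sym (P.cong₂ _+_ (setColumns-p M p≢q colp y i) (setColumns-p M p≢q colq y i)))))
      where
      offp : ∀ x i {l} → l ≢ p → S sum y i l ≡ S x y i l
      offp x i {l} l≢p = P.cong (λ z → if ⌊ l ≟ q ⌋ then y i else z)
        (P.trans (setColumn-off M p sum i l≢p) (P.sym (setColumn-off M p x i l≢p)))

  det-2×2 : ∀ (M : Matrix 2) → det M ≈ M zero zero * M (suc zero) (suc zero) - M zero (suc zero) * M (suc zero) zero
  det-2×2 M = solve 4 (λ a b c d → con (+ 1) :* a :* (con (+ 1) :* d :* con (+ 1) :+ con (+ 0))
                                   :+ ((:- con (+ 1)) :* b :* (con (+ 1) :* c :* con (+ 1) :+ con (+ 0)) :+ con (+ 0))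
                                   := a :* d :- b :* c)
                      refl (M zero zero) (M zero (suc zero)) (M (suc zero) zero) (M (suc zero) (suc zero))

  private
    det-equalColumnsAtDistance : ∀ d {k} (M : Matrix k) {p q : Fin k} → toℕ q ≡ suc (toℕ p ℕ.+ d) →
      (∀ i → M i p ≈ M i q) → det M ≈ 0#
    det-equalColumnsAtDistance zero    M q=1+p+0 = det-equalAdjacentColumns M (P.trans q=1+p+0 (P.cong suc (ℕP.+-identityʳ _)))
    det-equalColumnsAtDistance (suc d) {suc k} M {p} {suc q₀} q=2+p+d Mₚ≈M_q = begin
      det M           ≈⟨ sym (-‿involutive _) ⟩
      - - det M       ≈⟨ -‿cong (sym (det-swapAdjacentColumns M r⋖q)) ⟩
      - det M′        ≈⟨ -‿cong (det-equalColumnsAtDistance d M′ r=1+p+d λ i →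
                           trans (reflexive (setColumns-off M r≢q (column M q) (column M r) i p≢r p≢q)) (trans (Mₚ≈M_q i)
                                 (sym (reflexive (setColumns-p M r≢q (column M q) (column M r) i))))) ⟩
      - 0#            ≈⟨ -0#≈0# ⟩
      0#              ∎
      where
      q = suc q₀
      r = inject₁ q₀
      r=1+p+d : toℕ r ≡ suc (toℕ p ℕ.+ d)
      r=1+p+d = P.trans (toℕ-inject₁ q₀) (P.trans (ℕP.suc-injective q=2+p+d) (ℕP.+-suc (toℕ p) d))
      r⋖q : Adjacent r q
      r⋖q = P.cong suc (P.sym (toℕ-inject₁ q₀))
      r≢q = adjacent⇒≢ r⋖q
      p≢r : p ≢ r
      p≢r P.refl = ℕP.<-irrefl r=1+p+d (ℕ.s≤s (ℕP.m≤m+n (toℕ p) d))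
      p≢q : p ≢ q
      p≢q P.refl = ℕP.<-irrefl q=2+p+d (ℕ.s≤s (ℕP.m≤m+n (toℕ p) (suc d)))
      M′ = setColumns M r q (column M q) (column M r)

  det-equalColumns : ∀ {k} (M : Matrix k) {p q : Fin k} → p ≢ q → (∀ i → M i p ≈ M i q) → det M ≈ 0#
  det-equalColumns M {p} {q} p≢q Mₚ≈M_q with ℕP.<-cmp (toℕ p) (toℕ q)
  ... | tri≈ _ p=q _ = contradiction (toℕ-injective p=q) p≢q
  ... | tri< p<q _ _ = let d , p+d=q = ℕP.m≤n⇒∃[o]m+o≡n p<q in
                       det-equalColumnsAtDistance d M (P.sym p+d=q) Mₚ≈M_q
  ... | tri> _ _ q<p = let d , q+d=p = ℕP.m≤n⇒∃[o]m+o≡n q<p in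
                       det-equalColumnsAtDistance d M (P.sym q+d=p) (λ i → sym (Mₚ≈M_q i))

  det-linearΣAt : ∀ {k m} (M : Matrix k) (p : Fin k) (c : Fin m → Carrier) (N : Fin m → Fin k → Carrier) →
    det (setColumn M p (λ i → Σ (λ j → c j * N j i))) ≈ Σ (λ j → c j * det (setColumn M p (N j)))
  det-linearΣAt {k} {zero} M p c N = begin
    det (setColumn M p (λ _ → 0#))  ≈⟨ det-linearAt p 0# 0# {N₁ = M} {M}
                                         (λ i l l≢p → reflexive (setColumn-off M p _ i l≢p))
                                         (λ i l l≢p → reflexive (setColumn-off M p _ i l≢p))
                                         (λ i → trans (reflexive (setColumn-at M p _ i))
                                                      (sym (trans (+-cong (zeroˡ _) (zeroˡ _)) (+-identityˡ _)))) ⟩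
    0# * det M + 0# * det M        ≈⟨ trans (+-cong (zeroˡ _) (zeroˡ _)) (+-identityˡ _) ⟩
    0#                             ∎
  det-linearΣAt {k} {suc m} M p c N = begin
    det (setColumn M p col)
      ≈⟨ det-linearAt p (c zero) 1# (setColumn-agreeOff M p col (N zero)) (setColumn-agreeOff M p col rest)
           (λ i → trans (reflexive (setColumn-at M p col i))
                        (+-cong (*-congˡ (sym (reflexive (setColumn-at M p (N zero) i))))
                                (trans (sym (*-identityˡ _)) (*-congˡ (sym (reflexive (setColumn-at M p rest i))))))) ⟩
    c zero * det (setColumn M p (N zero)) + 1# * det (setColumn M p rest)
      ≈⟨ +-congˡ (trans (*-identityˡ _) (det-linearΣAt M p (λ j → c (suc j)) (λ j → N (suc j)))) ⟩
    Σ (λ j → c j * det (setColumn M p (N j))) ∎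
    where
    col rest : Fin k → Carrier
    col i  = Σ (λ j → c j * N j i)
    rest i = Σ (λ j → c (suc j) * N (suc j) i)

  det-addColumnCombination : ∀ {k} (M : Matrix k) (p : Fin k) (c : Fin k → Carrier) → c p ≈ 0# →
    det (setColumn M p (λ i → M i p + Σ (λ j → c j * M i j))) ≈ det M
  det-addColumnCombination {k} M p c cₚ≈0 = begin
    det (setColumn M p new)
      ≈⟨ det-additiveAt p (setColumn-agreeOff M p new old) (setColumn-agreeOff M p new comb)
           (λ i → trans (reflexive (setColumn-at M p new i))
                        (sym (+-cong (reflexive (setColumn-at M p old i)) (reflexive (setColumn-at M p comb i))))) ⟩
    det (setColumn M p old) + det (setColumn M p comb)
      ≈⟨ +-cong (det-cong unchanged) (det-linearΣAt M p c (λ j i → M i j)) ⟩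
    det M + Σ (λ j → c j * det (setColumn M p (λ i → M i j)))
      ≈⟨ +-congˡ (Σ-zero repeated) ⟩
    det M + 0#  ≈⟨ +-identityʳ _ ⟩
    det M       ∎
    where
    old comb new : Fin k → Carrier
    old i  = M i p
    comb i = Σ (λ j → c j * M i j)
    new i  = M i p + comb i
    unchanged : ∀ i l → setColumn M p old i l ≈ M i l
    unchanged i l with l ≟ p
    ... | yes P.refl = refl
    ... | no _       = refl
    repeated : ∀ j → c j * det (setColumn M p (λ i → M i j)) ≈ 0#
    repeated j with j ≟ p
    ... | yes P.refl = trans (*-congʳ cₚ≈0) (zeroˡ _)
    ... | no j≢p = trans (*-congˡ (det-equalColumns _ (j≢p ∘ P.sym) λ i →
                     trans (reflexive (setColumn-at M p (λ i → M i j) i))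
                           (sym (reflexive (setColumn-off M p (λ i → M i j) i j≢p))))) (zeroʳ _)

  addColumnCombinations : ∀ {k} → Matrix k → (Fin k → Bool) → (Fin k → Fin k → Carrier) → Matrix k
  addColumnCombinations M T c i l = if T l then M i l + Σ (λ j → c j l * M i j) else M i l

  addColumnCombinations-marked : ∀ {k} (M : Matrix k) T c i {l} → T l ≡ true →
    addColumnCombinations M T c i l ≡ M i l + Σ (λ j → c j l * M i j)
  addColumnCombinations-marked M T c i Tl rewrite Tl = P.refl

  addColumnCombinations-unmarked : ∀ {k} (M : Matrix k) T c i {l} → T l ≡ false →
    addColumnCombinations M T c i l ≡ M i l
  addColumnCombinations-unmarked M T c i Tl rewrite Tl = P.refl

  module _ {k} (M : Matrix k) (T : Fin k → Bool) (c : Fin k → Fin k → Carrier)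
           (unmarkedOnly : ∀ j l → T j ≡ true → c j l ≈ 0#) where
    private
      comb : Matrix k
      comb i l = Σ (λ j → c j l * M i j)

      before : ℕ → Matrix k
      before r i l = if T l then (if toℕ l ℕ.<ᵇ r then M i l + comb i l else M i l) else M i l

      sources-unchanged : ∀ r i j l → c j l * before r i j ≈ c j l * M i j
      sources-unchanged r i j l with T j in Tj
      ... | true  = trans (*-congʳ (unmarkedOnly j l Tj)) (trans (zeroˡ _) (sym (trans (*-congʳ (unmarkedOnly j l Tj)) (zeroˡ _))))
      ... | false = refl

      step : ∀ r (r<k : r ℕ.< k) → det (before (suc r)) ≈ det (before r)
      step r r<k = trans (det-cong next) (det-addColumnCombination (before r) p c′ c′ₚ≈0)
        where
        p = fromℕ< r<k
        p=r : toℕ p ≡ r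
        p=r = toℕ-fromℕ< r<k
        c′ : Fin k → Carrier
        c′ j = if T p then c j p else 0#
        c′ₚ≈0 : c′ p ≈ 0#
        c′ₚ≈0 with T p in Tp
        ... | true  = unmarkedOnly p p Tp
        ... | false = refl
        next : ∀ i l → before (suc r) i l ≈ setColumn (before r) p (λ i → before r i p + Σ (λ j → c′ j * before r i j)) i l
        next i l with l ≟ p
        next i l | yes P.refl with T l in Tl | toℕ l ℕ.<ᵇ suc r | ℕP.<ᵇ-reflects-< (toℕ l) (suc r)
                                             | toℕ l ℕ.<ᵇ r     | ℕP.<ᵇ-reflects-< (toℕ l) r
        ... | true  | true  | _      | false | _      = +-congˡ (sym (Σ-cong (λ j → sources-unchanged r i j l)))
        ... | true  | _     | _      | true  | ofʸ l<r = contradiction l<r (ℕP.<-irrefl p=r)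
        ... | true  | false | ofⁿ l≮1+r | _  | _      = contradiction (P.subst (ℕ._< suc r) (P.sym p=r) (ℕP.n<1+n r)) l≮1+r
        ... | false | _     | _      | _     | _      = sym (trans (+-congˡ (Σ-zero λ j → zeroˡ (before r i j))) (+-identityʳ _))
        next i l | no l≢p with T l
        ... | false = refl
        ... | true with toℕ l ℕ.<ᵇ suc r | ℕP.<ᵇ-reflects-< (toℕ l) (suc r) | toℕ l ℕ.<ᵇ r | ℕP.<ᵇ-reflects-< (toℕ l) r
        ... | true  | _         | true  | _       = refl
        ... | false | _         | false | _       = refl
        ... | false | ofⁿ l≮1+r | true  | ofʸ l<r = contradiction (ℕP.m<n⇒m<1+n l<r) l≮1+r
        ... | true  | ofʸ l<1+r | false | ofⁿ l≮r =
          contradiction (toℕ-injective (P.trans (ℕP.≤-antisym (ℕP.≤-pred l<1+r) (ℕP.≮⇒≥ l≮r)) (P.sym p=r))) l≢p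

      upTo : ∀ r → r ℕ.≤ k → det (before r) ≈ det M
      upTo zero    _   = det-cong untouched
        where
        untouched : ∀ i l → before zero i l ≈ M i l
        untouched i l with T l
        ... | false = refl
        ... | true  = refl
      upTo (suc r) r<k = trans (step r r<k) (upTo r (ℕP.<⇒≤ r<k))

      finished : ∀ i l → addColumnCombinations M T c i l ≈ before k i l
      finished i l with T l
      ... | false = refl
      ... | true with toℕ l ℕ.<ᵇ k | ℕP.<ᵇ-reflects-< (toℕ l) k
      ... | true  | _        = refl
      ... | false | ofⁿ l≮k = contradiction (toℕ<n l) l≮k

    -- The marked columns are modified one at a time; each step is an instance of
    -- det-addColumnCombination because only unmarked columns are ever added.
    det-addColumnCombinations : det (addColumnCombinations M T c) ≈ det M
    det-addColumnCombinations = trans (det-cong finished) (upTo k ℕP.≤-refl)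

module BlockDeterminant {c ℓ} (K : Field c ℓ) where
  open Field K hiding (zero)
  open FieldOps K
  open Determinant K public
  open import Algebra.Properties.Ring ring using (-‿distribˡ-*)

  ↑-view : ∀ {n m} (x : Fin (n ℕ.+ m)) → (∃[ i ] x ≡ i ↑ˡ m) ⊎ (∃[ w ] x ≡ n ↑ʳ w)
  ↑-view {n} x with splitAt n x in eq
  ... | inj₁ i = inj₁ (i , P.sym (splitAt⁻¹-↑ˡ eq))
  ... | inj₂ w = inj₂ (w , P.sym (splitAt⁻¹-↑ʳ eq))

  punchIn-↑ˡ : ∀ {n} m (j : Fin (suc n)) (l : Fin n) → punchIn (j ↑ˡ m) (l ↑ˡ m) ≡ punchIn j l ↑ˡ m
  punchIn-↑ˡ m zero    l       = P.refl
  punchIn-↑ˡ m (suc j) zero    = P.refl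
  punchIn-↑ˡ m (suc j) (suc l) = P.cong suc (punchIn-↑ˡ m j l)

  punchIn-↑ʳ : ∀ {n m} (j : Fin (suc n)) (w : Fin m) → punchIn (j ↑ˡ m) (n ↑ʳ w) ≡ suc n ↑ʳ w
  punchIn-↑ʳ          zero    w = P.refl
  punchIn-↑ʳ {suc n} (suc j) w = P.cong suc (punchIn-↑ʳ {n} j w)

  sgn-↑ˡ : ∀ {n} m (j : Fin n) → sgn (j ↑ˡ m) ≡ sgn j
  sgn-↑ˡ m zero    = P.refl
  sgn-↑ˡ m (suc j) = P.cong -_ (sgn-↑ˡ m j)

  det-identity : ∀ {k} (N : Matrix k) → (∀ i j → N i j ≈ δ i j) → det N ≈ 1#
  det-identity {zero}  N N≈I = refl
  det-identity {suc k} N N≈I = begin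
    1# * N zero zero * det (minor N zero) + Σ (λ j → sgn (suc j) * N zero (suc j) * det (minor N (suc j)))
      ≈⟨ +-cong (*-cong (*-congˡ (trans (N≈I zero zero) (δ-refl {suc k} zero)))
                        (det-identity (minor N zero) λ i j → trans (N≈I (suc i) (suc j)) (δ-suc i j)))
                (Σ-zero {k} λ j → trans (*-congʳ (trans (*-congˡ (trans (N≈I zero (suc j)) (δ-≢ {suc k} {zero} {suc j} λ ())))
                                                       (zeroʳ (sgn (suc j)))))
                                        (zeroˡ (det (minor N (suc j))))) ⟩
    1# * 1# * 1# + 0#  ≈⟨ trans (+-identityʳ _) (trans (*-identityʳ _) (*-identityʳ _)) ⟩
    1#                 ∎

  det-blockLowerTriangular : ∀ {n m} (N : Matrix (n ℕ.+ m)) (A : Matrix n) (D : Matrix m) →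
    (∀ i j → N (i ↑ˡ m) (j ↑ˡ m) ≈ A i j) → (∀ i w → N (i ↑ˡ m) (n ↑ʳ w) ≈ 0#) →
    (∀ w w′ → N (n ↑ʳ w) (n ↑ʳ w′) ≈ D w w′) → det N ≈ det A * det D
  det-blockLowerTriangular {zero}  N A D N≈A N≈0 N≈D = trans (det-cong N≈D) (sym (*-identityˡ _))
  det-blockLowerTriangular {suc n} {m} N A D N≈A N≈0 N≈D = begin
    det N                                             ≈⟨ Σ-splitAt {suc n} {m} T ⟩
    Σ (λ j → T (j ↑ˡ m)) + Σ (λ w → T (suc n ↑ʳ w))   ≈⟨ +-cong (Σ-cong {suc n} left) (Σ-zero {m} right) ⟩
    Σ (λ j → TA j * det D) + 0#                       ≈⟨ +-identityʳ _ ⟩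
    Σ (λ j → TA j * det D)                            ≈⟨ sym (Σ-distribʳ (det D) TA) ⟩
    det A * det D                                     ∎
    where
    T : Fin (suc n ℕ.+ m) → Carrier
    T j = sgn j * N zero j * det (minor N j)
    TA : Fin (suc n) → Carrier
    TA j = sgn j * A zero j * det (minor A j)
    right : ∀ w → T (suc n ↑ʳ w) ≈ 0#
    right w = trans (*-congʳ (trans (*-congˡ (N≈0 zero w)) (zeroʳ _))) (zeroˡ _)
    left : ∀ j → T (j ↑ˡ m) ≈ TA j * det D
    left j = trans (*-cong (*-cong (reflexive (sgn-↑ˡ m j)) (N≈A zero j))
      (det-blockLowerTriangular (minor N (j ↑ˡ m)) (minor A j) D
        (λ i l → trans (reflexive (P.cong (N (suc (i ↑ˡ m))) (punchIn-↑ˡ m j l))) (N≈A (suc i) (punchIn j l)))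
        (λ i w → trans (reflexive (P.cong (N (suc (i ↑ˡ m))) (punchIn-↑ʳ j w))) (N≈0 (suc i) w))
        (λ w w′ → trans (reflexive (P.cong (N (suc (n ↑ʳ w))) (punchIn-↑ʳ j w′))) (N≈D w w′))))
      (sym (*-assoc _ _ _))

  det-blockUpperTriangularWithIdentity : ∀ {n m} (N : Matrix (n ℕ.+ m)) (A : Matrix n) →
    (∀ i j → N (i ↑ˡ m) (j ↑ˡ m) ≈ A i j) → (∀ w j → N (n ↑ʳ w) (j ↑ˡ m) ≈ 0#) →
    (∀ w w′ → N (n ↑ʳ w) (n ↑ʳ w′) ≈ δ w w′) → det N ≈ det A
  det-blockUpperTriangularWithIdentity {zero}  N A N≈A N≈0 N≈I = det-identity N N≈I
  det-blockUpperTriangularWithIdentity {suc n} {m} N A N≈A N≈0 N≈I = begin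
    det N                                             ≈⟨ Σ-splitAt {suc n} {m} T ⟩
    Σ (λ j → T (j ↑ˡ m)) + Σ (λ w → T (suc n ↑ʳ w))   ≈⟨ +-cong (Σ-cong {suc n} left) (Σ-zero {m} right) ⟩
    det A + 0#                                        ≈⟨ +-identityʳ _ ⟩
    det A                                             ∎
    where
    T : Fin (suc n ℕ.+ m) → Carrier
    T j = sgn j * N zero j * det (minor N j)
    offDiagonal : ∀ w y → y ≢ suc n ↑ʳ w → N (suc n ↑ʳ w) y ≈ 0#
    offDiagonal w y y≢w with ↑-view {suc n} {m} y
    ... | inj₁ (i , P.refl)  = N≈0 w i
    ... | inj₂ (w′ , P.refl) = trans (N≈I w w′) (δ-≢ λ w=w′ → y≢w (P.cong (suc n ↑ʳ_) (P.sym w=w′)))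
    right : ∀ w → T (suc n ↑ʳ w) ≈ 0#
    right w = trans (*-congˡ (det-zeroRow (minor N (suc n ↑ʳ w)) (n ↑ʳ w) λ l →
                      offDiagonal w (punchIn (suc n ↑ʳ w) l) (punchInᵢ≢i (suc n ↑ʳ w) l)))
                    (zeroʳ _)
    left : ∀ j → T (j ↑ˡ m) ≈ sgn j * A zero j * det (minor A j)
    left j = *-cong (*-cong (reflexive (sgn-↑ˡ m j)) (N≈A zero j))
      (det-blockUpperTriangularWithIdentity (minor N (j ↑ˡ m)) (minor A j)
        (λ i l → trans (reflexive (P.cong (N (suc (i ↑ˡ m))) (punchIn-↑ˡ m j l))) (N≈A (suc i) (punchIn j l)))
        (λ w l → trans (reflexive (P.cong (N (suc (n ↑ʳ w))) (punchIn-↑ˡ m j l))) (N≈0 w (punchIn j l)))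
        (λ w w′ → trans (reflexive (P.cong (N (suc (n ↑ʳ w))) (punchIn-↑ʳ j w′))) (N≈I w w′)))

  block : ∀ {n m} → Matrix n → (Fin n → Fin m → Carrier) → (Fin m → Fin n → Carrier) → Matrix m →
          Matrix (n ℕ.+ m)
  block {n} A B C D x y =
    [ (λ i → [ A i , B i ]′ (splitAt n y)) , (λ w → [ C w , D w ]′ (splitAt n y)) ]′ (splitAt n x)

  module _ {n m} (A : Matrix n) (B : Fin n → Fin m → Carrier) (C : Fin m → Fin n → Carrier) (D : Matrix m) where
    block-ˡˡ : ∀ i j → block A B C D (i ↑ˡ m) (j ↑ˡ m) ≡ A i j
    block-ˡˡ i j rewrite splitAt-↑ˡ n i m | splitAt-↑ˡ n j m = P.refl

    block-ˡʳ : ∀ i w → block A B C D (i ↑ˡ m) (n ↑ʳ w) ≡ B i w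
    block-ˡʳ i w rewrite splitAt-↑ˡ n i m | splitAt-↑ʳ n m w = P.refl

    block-ʳˡ : ∀ w j → block A B C D (n ↑ʳ w) (j ↑ˡ m) ≡ C w j
    block-ʳˡ w j rewrite splitAt-↑ʳ n m w | splitAt-↑ˡ n j m = P.refl

    block-ʳʳ : ∀ w w′ → block A B C D (n ↑ʳ w) (n ↑ʳ w′) ≡ D w w′
    block-ʳʳ w w′ rewrite splitAt-↑ʳ n m w | splitAt-↑ʳ n m w′ = P.refl

  isLeft : ∀ {n m} → Fin (n ℕ.+ m) → Bool
  isLeft {n} x = [ const true , const false ]′ (splitAt n x)

  isLeft-↑ˡ : ∀ {n} m (i : Fin n) → isLeft {n} {m} (i ↑ˡ m) ≡ true
  isLeft-↑ˡ {n} m i rewrite splitAt-↑ˡ n i m = P.refl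

  isLeft-↑ʳ : ∀ n {m} (w : Fin m) → isLeft {n} {m} (n ↑ʳ w) ≡ false
  isLeft-↑ʳ n {m} w rewrite splitAt-↑ʳ n m w = P.refl

  private
    O : ∀ {a b} → Fin a → Fin b → Carrier
    O _ _ = 0#

  -- Subtracting Σ_w C w j times column w of the identity block from column j clears C.
  det-blockWithIdentityCorner : ∀ {n m} (A : Matrix n) (B : Fin n → Fin m → Carrier)
    (C : Fin m → Fin n → Carrier) → det (block A B C δ) ≈ det (λ i j → A i j - Σ (λ w → B i w * C w j))
  det-blockWithIdentityCorner {n} {m} A B C = begin
    det N           ≈⟨ sym (det-addColumnCombinations N left? coeff fromRightOnly) ⟩
    det N′          ≈⟨ det-blockUpperTriangularWithIdentity N′ _ N′-ˡˡ N′-ʳˡ N′-ʳʳ ⟩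
    det (λ i j → A i j - Σ (λ w → B i w * C w j)) ∎
    where
    N = block A B C δ
    left? = isLeft {n} {m}
    −C : Fin m → Fin n → Carrier
    −C w j = - C w j
    coeff = block O O −C O
    N′ = addColumnCombinations N left? coeff
    fromRightOnly : ∀ y x → left? y ≡ true → coeff y x ≈ 0#
    fromRightOnly y x y-left with ↑-view {n} {m} y | ↑-view {n} {m} x
    ... | inj₁ (i , P.refl) | inj₁ (j , P.refl) = reflexive (block-ˡˡ O O −C O i j)
    ... | inj₁ (i , P.refl) | inj₂ (w , P.refl) = reflexive (block-ˡʳ O O −C O i w)
    ... | inj₂ (w , P.refl) | _ = contradiction (P.trans (P.sym y-left) (isLeft-↑ʳ n w)) λ ()
    added : ∀ r j → Σ (λ y → coeff y (j ↑ˡ m) * N r y) ≈ - Σ (λ w → N r (n ↑ʳ w) * C w j)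
    added r j = begin
      Σ (λ y → coeff y (j ↑ˡ m) * N r y)
        ≈⟨ Σ-splitAt {n} {m} _ ⟩
      Σ (λ i → coeff (i ↑ˡ m) (j ↑ˡ m) * N r (i ↑ˡ m)) + Σ (λ w → coeff (n ↑ʳ w) (j ↑ˡ m) * N r (n ↑ʳ w))
        ≈⟨ +-cong (Σ-zero {n} λ i → trans (*-congʳ (reflexive (block-ˡˡ O O −C O i j))) (zeroˡ _))
                  (Σ-cong {m} λ w → *-congʳ (reflexive (block-ʳˡ O O −C O w j))) ⟩
      0# + Σ (λ w → - C w j * N r (n ↑ʳ w))
        ≈⟨ trans (+-identityˡ _) (trans (Σ-cong {m} λ w → trans (sym (-‿distribˡ-* _ _)) (-‿cong (*-comm _ _)))
                                        (sym (Σ-neg (λ w → N r (n ↑ʳ w) * C w j)))) ⟩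
      - Σ (λ w → N r (n ↑ʳ w) * C w j) ∎
    N′-ˡˡ : ∀ i j → N′ (i ↑ˡ m) (j ↑ˡ m) ≈ A i j - Σ (λ w → B i w * C w j)
    N′-ˡˡ i j = trans (reflexive (addColumnCombinations-marked N left? coeff (i ↑ˡ m) (isLeft-↑ˡ {n} m j))) $
      +-cong (reflexive (block-ˡˡ A B C δ i j))
             (trans (added (i ↑ˡ m) j) (-‿cong (Σ-cong {m} λ w → *-congʳ (reflexive (block-ˡʳ A B C δ i w)))))
    N′-ʳˡ : ∀ w j → N′ (n ↑ʳ w) (j ↑ˡ m) ≈ 0#
    N′-ʳˡ w j = begin
      N′ (n ↑ʳ w) (j ↑ˡ m)
        ≡⟨ addColumnCombinations-marked N left? coeff (n ↑ʳ w) (isLeft-↑ˡ {n} m j) ⟩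
      N (n ↑ʳ w) (j ↑ˡ m) + Σ (λ y → coeff y (j ↑ˡ m) * N (n ↑ʳ w) y)
        ≈⟨ +-cong (reflexive (block-ʳˡ A B C δ w j)) (added (n ↑ʳ w) j) ⟩
      C w j - Σ (λ w′ → N (n ↑ʳ w) (n ↑ʳ w′) * C w′ j)
        ≈⟨ +-congˡ (-‿cong (trans (Σ-cong {m} λ w′ → *-congʳ (reflexive (block-ʳʳ A B C δ w w′)))
                                  (Σ-δˡ w (λ w′ → C w′ j)))) ⟩
      C w j - C w j  ≈⟨ -‿inverseʳ _ ⟩
      0#             ∎
    N′-ʳʳ : ∀ w w′ → N′ (n ↑ʳ w) (n ↑ʳ w′) ≈ δ w w′
    N′-ʳʳ w w′ = reflexive (P.trans (addColumnCombinations-unmarked N left? coeff (n ↑ʳ w) (isLeft-↑ʳ n w′))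
                                    (block-ʳʳ A B C δ w w′))

  Σ-rightInverse : ∀ {n m} (G H : Matrix n) (B : Fin n → Fin m → Carrier) → (∀ i j → Σ (λ b → G i b * H b j) ≈ δ i j) →
    ∀ i w → Σ (λ j → G i j * Σ (λ b → H j b * B b w)) ≈ B i w
  Σ-rightInverse {n} G H B GH≈I i w = begin
    Σ (λ j → G i j * Σ (λ b → H j b * B b w))       ≈⟨ Σ-cong {n} (λ j → Σ-distribˡ (G i j) (λ b → H j b * B b w)) ⟩
    Σ (λ j → Σ (λ b → G i j * (H j b * B b w)))   ≈⟨ Σ-comm (λ j b → G i j * (H j b * B b w)) ⟩
    Σ (λ b → Σ (λ j → G i j * (H j b * B b w)))   ≈⟨ Σ-cong {n} (λ b → trans (Σ-cong {n} λ j → sym (*-assoc _ _ _))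
                                                                              (sym (Σ-distribʳ (B b w) (λ j → G i j * H j b)))) ⟩
    Σ (λ b → Σ (λ j → G i j * H j b) * B b w)     ≈⟨ Σ-cong {n} (λ b → *-congʳ (GH≈I i b)) ⟩
    Σ (λ b → δ i b * B b w)                       ≈⟨ Σ-δˡ i (λ b → B b w) ⟩
    B i w                                         ∎

  -- With G H = I, subtracting Σ_j (H B) j w times column j from column w clears B.
  det-blockWithInvertibleCorner : ∀ {n m} (G H : Matrix n) (B : Fin n → Fin m → Carrier)
    (C : Fin m → Fin n → Carrier) (D : Matrix m) → (∀ i j → Σ (λ b → G i b * H b j) ≈ δ i j) →
    det (block G B C D) ≈ det G * det (λ w w′ → D w w′ - Σ (λ j → C w j * Σ (λ b → H j b * B b w′)))
  det-blockWithInvertibleCorner {n} {m} G H B C D GH≈I = begin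
    det N           ≈⟨ sym (det-addColumnCombinations N right? coeff fromLeftOnly) ⟩
    det N′          ≈⟨ det-blockLowerTriangular N′ G _ N′-ˡˡ N′-ˡʳ N′-ʳʳ ⟩
    det G * det (λ w w′ → D w w′ - Σ (λ j → C w j * HB j w′)) ∎
    where
    N = block G B C D
    right? = not ∘ isLeft {n} {m}
    HB : Fin n → Fin m → Carrier
    HB j w = Σ (λ b → H j b * B b w)
    −HB : Fin n → Fin m → Carrier
    −HB j w = - HB j w
    coeff = block O −HB O O
    N′ = addColumnCombinations N right? coeff
    fromLeftOnly : ∀ y x → right? y ≡ true → coeff y x ≈ 0#
    fromLeftOnly y x y-right with ↑-view {n} {m} y | ↑-view {n} {m} x
    ... | inj₂ (w , P.refl) | inj₁ (j , P.refl) = reflexive (block-ʳˡ O −HB O O w j)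
    ... | inj₂ (w , P.refl) | inj₂ (w′ , P.refl) = reflexive (block-ʳʳ O −HB O O w w′)
    ... | inj₁ (i , P.refl) | _ = contradiction (P.trans (P.sym y-right) (P.cong not (isLeft-↑ˡ {n} m i))) λ ()
    right-↑ˡ : ∀ j → right? (j ↑ˡ m) ≡ false
    right-↑ˡ j = P.cong not (isLeft-↑ˡ {n} m j)
    right-↑ʳ : ∀ w → right? (n ↑ʳ w) ≡ true
    right-↑ʳ w = P.cong not (isLeft-↑ʳ n w)
    added : ∀ r w → Σ (λ y → coeff y (n ↑ʳ w) * N r y) ≈ - Σ (λ j → N r (j ↑ˡ m) * HB j w)
    added r w = begin
      Σ (λ y → coeff y (n ↑ʳ w) * N r y)
        ≈⟨ Σ-splitAt {n} {m} _ ⟩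
      Σ (λ j → coeff (j ↑ˡ m) (n ↑ʳ w) * N r (j ↑ˡ m)) + Σ (λ w′ → coeff (n ↑ʳ w′) (n ↑ʳ w) * N r (n ↑ʳ w′))
        ≈⟨ +-cong (Σ-cong {n} λ j → *-congʳ (reflexive (block-ˡʳ O −HB O O j w)))
                  (Σ-zero {m} λ w′ → trans (*-congʳ (reflexive (block-ʳʳ O −HB O O w′ w))) (zeroˡ _)) ⟩
      Σ (λ j → - HB j w * N r (j ↑ˡ m)) + 0#
        ≈⟨ trans (+-identityʳ _) (trans (Σ-cong {n} λ j → trans (sym (-‿distribˡ-* _ _)) (-‿cong (*-comm _ _)))
                                        (sym (Σ-neg (λ j → N r (j ↑ˡ m) * HB j w)))) ⟩
      - Σ (λ j → N r (j ↑ˡ m) * HB j w) ∎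
    N′-ˡˡ : ∀ i j → N′ (i ↑ˡ m) (j ↑ˡ m) ≈ G i j
    N′-ˡˡ i j = reflexive (P.trans (addColumnCombinations-unmarked N right? coeff (i ↑ˡ m) (right-↑ˡ j))
                                   (block-ˡˡ G B C D i j))
    N′-ˡʳ : ∀ i w → N′ (i ↑ˡ m) (n ↑ʳ w) ≈ 0#
    N′-ˡʳ i w = begin
      N′ (i ↑ˡ m) (n ↑ʳ w)
        ≡⟨ addColumnCombinations-marked N right? coeff (i ↑ˡ m) (right-↑ʳ w) ⟩
      N (i ↑ˡ m) (n ↑ʳ w) + Σ (λ y → coeff y (n ↑ʳ w) * N (i ↑ˡ m) y)
        ≈⟨ +-cong (reflexive (block-ˡʳ G B C D i w)) (added (i ↑ˡ m) w) ⟩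
      B i w - Σ (λ j → N (i ↑ˡ m) (j ↑ˡ m) * HB j w)
        ≈⟨ +-congˡ (-‿cong (trans (Σ-cong {n} λ j → *-congʳ (reflexive (block-ˡˡ G B C D i j))) (Σ-rightInverse G H B GH≈I i w))) ⟩
      B i w - B i w  ≈⟨ -‿inverseʳ _ ⟩
      0#             ∎
    N′-ʳʳ : ∀ w w′ → N′ (n ↑ʳ w) (n ↑ʳ w′) ≈ D w w′ - Σ (λ j → C w j * HB j w′)
    N′-ʳʳ w w′ = trans (reflexive (addColumnCombinations-marked N right? coeff (n ↑ʳ w) (right-↑ʳ w′))) $
      +-cong (reflexive (block-ʳʳ G B C D w w′))
             (trans (added (n ↑ʳ w) w′) (-‿cong (Σ-cong {n} λ j → *-congʳ (reflexive (block-ʳˡ G B C D w j)))))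

  det-blockDiagonal : ∀ {n m} (N : Matrix (n ℕ.* m)) (M : Fin n → Matrix m) →
    (∀ i j i′ j′ → N (combine i j) (combine i′ j′) ≈ δ i i′ * M i j j′) → det N ≈ Π (λ i → det (M i))
  det-blockDiagonal {zero}      N M N≈diag = refl
  det-blockDiagonal {suc n} {m} N M N≈diag =
    trans (det-blockLowerTriangular N (M zero) rest first zeroBlock (λ _ _ → refl))
          (*-congˡ (det-blockDiagonal rest (λ i → M (suc i)) λ i j i′ j′ →
                      trans (N≈diag (suc i) j (suc i′) j′) (*-congʳ (δ-suc i i′))))
    where
    rest : Matrix (n ℕ.* m)
    rest w w′ = N (m ↑ʳ w) (m ↑ʳ w′)
    first : ∀ j j′ → N (j ↑ˡ n ℕ.* m) (j′ ↑ˡ n ℕ.* m) ≈ M zero j j′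
    first j j′ = trans (N≈diag zero j zero j′) (trans (*-congʳ (δ-refl {suc n} zero)) (*-identityˡ _))
    zeroBlock : ∀ j w → N (j ↑ˡ n ℕ.* m) (m ↑ʳ w) ≈ 0#
    zeroBlock j w = begin
      N (j ↑ˡ n ℕ.* m) (m ↑ʳ w)                    ≡⟨ P.cong (λ z → N (j ↑ˡ n ℕ.* m) (m ↑ʳ z)) (P.sym (combine-remQuot {n} m w)) ⟩
      N (j ↑ˡ n ℕ.* m) (combine (suc i′) j′)       ≈⟨ N≈diag zero j (suc i′) j′ ⟩
      δ zero (suc i′) * M zero j j′                ≈⟨ trans (*-congʳ (δ-≢ {suc n} {zero} {suc i′} λ ())) (zeroˡ _) ⟩
      0#                                           ∎
      where
      i′ = proj₁ (remQuot {n} m w)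
      j′ = proj₂ (remQuot {n} m w)

module Proof {c ℓ r} (K : Field c ℓ) (Δ : Digraph)
    (τ₁ τ₂ : Fin (Digraph.nA Δ) → Field.Carrier K)
    (_≼_ : Rel (Fin (Digraph.nV Δ)) r) (≼-dto : IsDecTotalOrder _≡_ _≼_)
    (t : Field.Carrier K) where
  open Field K hiding (zero)
  open FieldOps K
  open BlockDeterminant K
  open Construction K Δ τ₁ τ₂ _≼_ ≼-dto t
  open Digraph Δ
  open IsDecTotalOrder ≼-dto using (_≤?_; total; antisym) renaming (refl to ≼-refl)
  open import Algebra.Properties.Ring ring using (-0#≈0#)

  -- The block of Φ_Δ containing an arc

  le : V → V → Bool
  le u v = ⌊ u ≤? v ⌋

  le-sound : ∀ {u v} → le u v ≡ true → u ≼ v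
  le-sound {u} {v} eq with u ≤? v
  ... | yes u≼v = u≼v

  le-complete : ∀ {u v} → u ≼ v → le u v ≡ true
  le-complete {u} {v} u≼v with u ≤? v
  ... | yes _   = P.refl
  ... | no  u⋠v = contradiction u≼v u⋠v

  le-flip : ∀ {u v} → le u v ≡ false → le v u ≡ true
  le-flip {u} {v} eq with u ≤? v | total u v
  ... | no u⋠v | inj₁ u≼v = contradiction u≼v u⋠v
  ... | no _   | inj₂ v≼u = le-complete v≼u

  le-antisym : ∀ {u v} → le u v ≡ true → le v u ≡ true → u ≡ v
  le-antisym u≤v v≤u = antisym (le-sound u≤v) (le-sound v≤u)

  le-refl : ∀ u → le u u ≡ true
  le-refl u = le-complete ≼-refl

  inA-sound : ∀ {u v a} → inA u v a ≡ true → tl a ≡ u × hd a ≡ v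
  inA-sound {u} {v} {a} eq = ≟-sound (∧-conicalˡ _ _ eq) , ≟-sound (∧-conicalʳ ⌊ tl a ≟ u ⌋ _ eq)

  inA-complete : ∀ {u v a} → tl a ≡ u → hd a ≡ v → inA u v a ≡ true
  inA-complete tl≡u hd≡v = ∧-intro (≟-diag tl≡u) (≟-diag hd≡v)

  inA²-reverse : ∀ {a b} u v → tl b ≡ hd a → hd b ≡ tl a → inA² u v b ≡ inA² u v a
  inA²-reverse {a} {b} u v tl≡hd hd≡tl rewrite tl≡hd | hd≡tl =
    P.trans (P.cong₂ _∨_ (∧-comm ⌊ hd a ≟ u ⌋ _) (∧-comm ⌊ hd a ≟ v ⌋ _)) (∨-comm (inA v u a) _)

  isInv-sound : ∀ {a b} → isInv a b ≡ true → tl b ≡ hd a × hd b ≡ tl a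
  isInv-sound = inA-sound

  -- (lo a, hi a) is the unique element of Φ_Δ whose arc set 𝒜(lo a, hi a) contains a.
  lo hi : Arc → V
  lo a = if le (tl a) (hd a) then tl a else hd a
  hi a = if le (tl a) (hd a) then hd a else tl a

  data Endpoints (a : Arc) : Set where
    forward  : le (tl a) (hd a) ≡ true  → lo a ≡ tl a → hi a ≡ hd a → Endpoints a
    backward : le (tl a) (hd a) ≡ false → lo a ≡ hd a → hi a ≡ tl a → Endpoints a

  endpoints : ∀ a → Endpoints a
  endpoints a with le (tl a) (hd a) in eq
  ... | true  = forward  eq (P.cong (λ b → if b then tl a else hd a) eq) (P.cong (λ b → if b then hd a else tl a) eq)
  ... | false = backward eq (P.cong (λ b → if b then tl a else hd a) eq) (P.cong (λ b → if b then hd a else tl a) eq)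

  lo-hi-inΦ : ∀ a → inΦ (lo a) (hi a) ≡ true
  lo-hi-inA² : ∀ a → inA² (lo a) (hi a) a ≡ true
  lo-hi-inA² a with endpoints a
  ... | forward  _ lo≡ hi≡ = ∨-introˡ (inA-complete (P.sym lo≡) (P.sym hi≡))
  ... | backward _ lo≡ hi≡ = ∨-introʳ (inA-complete (P.sym hi≡) (P.sym lo≡))
  lo-hi-inΦ a = ∧-intro ordered (anyFin-intro (inA² (lo a) (hi a)) a (lo-hi-inA² a))
    where
    ordered : le (lo a) (hi a) ≡ true
    ordered with endpoints a
    ... | forward  le≡ lo≡ hi≡ = P.subst₂ (λ x y → le x y ≡ true) (P.sym lo≡) (P.sym hi≡) le≡
    ... | backward le≡ lo≡ hi≡ = P.subst₂ (λ x y → le x y ≡ true) (P.sym lo≡) (P.sym hi≡) (le-flip le≡)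

  inΦ-inA²⇒lo-hi : ∀ {a u v} → inΦ u v ≡ true → inA² u v a ≡ true → lo a ≡ u × hi a ≡ v
  inΦ-inA²⇒lo-hi {a} {u} {v} uv∈Φ a∈uv with ∨-elim a∈uv | endpoints a
  ... | inj₁ a∈𝒜uv | forward _ lo≡ hi≡ =
    let tl≡u , hd≡v = inA-sound a∈𝒜uv in P.trans lo≡ tl≡u , P.trans hi≡ hd≡v
  ... | inj₁ a∈𝒜uv | backward tl≰hd _ _ =
    let tl≡u , hd≡v = inA-sound a∈𝒜uv in
    contradiction (P.trans (P.sym tl≰hd) (P.subst₂ (λ x y → le x y ≡ true) (P.sym tl≡u) (P.sym hd≡v) u≤v)) λ ()
    where u≤v = ∧-conicalˡ _ _ uv∈Φ
  ... | inj₂ a∈𝒜vu | backward _ lo≡ hi≡ =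
    let tl≡v , hd≡u = inA-sound a∈𝒜vu in P.trans lo≡ hd≡u , P.trans hi≡ tl≡v
  ... | inj₂ a∈𝒜vu | forward tl≤hd lo≡ hi≡ =
    let tl≡v , hd≡u = inA-sound a∈𝒜vu
        u≡v = le-antisym (∧-conicalˡ _ _ uv∈Φ) (P.subst₂ (λ x y → le x y ≡ true) tl≡v hd≡u tl≤hd)
    in P.trans lo≡ (P.trans tl≡v (P.sym u≡v)) , P.trans hi≡ (P.trans hd≡u u≡v)

  Φ-partitionsArcs : ∀ a u v → (inΦ u v ∧ inA² u v a) ≡ (⌊ lo a ≟ u ⌋ ∧ ⌊ hi a ≟ v ⌋)
  Φ-partitionsArcs a u v = Bool-ext
    (λ both → let lo≡u , hi≡v = inΦ-inA²⇒lo-hi {a} (∧-conicalˡ _ _ both) (∧-conicalʳ (inΦ u v) _ both)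
              in ∧-intro (≟-diag lo≡u) (≟-diag hi≡v))
    (λ both → P.subst₂ (λ x y → inΦ x y ∧ inA² x y a ≡ true)
                       (≟-sound (∧-conicalˡ _ _ both)) (≟-sound (∧-conicalʳ ⌊ lo a ≟ u ⌋ _ both))
                       (∧-intro (lo-hi-inΦ a) (lo-hi-inA² a)))

  Σ-Φ-containing : ∀ a (g : V → V → Carrier) →
    Σ (λ u → Σ (λ v → [ inΦ u v ] * ([ inA² u v a ] * g u v))) ≈ g (lo a) (hi a)
  Σ-Φ-containing a g = begin
    Σ (λ u → Σ (λ v → [ inΦ u v ] * ([ inA² u v a ] * g u v)))
      ≈⟨ Σ-cong {nV} (λ u → Σ-cong {nV} λ v → trans (sym (*-assoc _ _ _)) (*-congʳ (begin
           [ inΦ u v ] * [ inA² u v a ]                ≈⟨ sym ([]-∧ (inΦ u v) _) ⟩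
           [ inΦ u v ∧ inA² u v a ]                    ≡⟨ P.cong [_] (Φ-partitionsArcs a u v) ⟩
           [ ⌊ lo a ≟ u ⌋ ∧ ⌊ hi a ≟ v ⌋ ]            ≈⟨ []-∧ ⌊ lo a ≟ u ⌋ _ ⟩
           δ (lo a) u * δ (hi a) v                     ∎))) ⟩
    Σ (λ u → Σ (λ v → δ (lo a) u * δ (hi a) v * g u v))  ≈⟨ Σ-δ² (lo a) (hi a) g ⟩
    g (lo a) (hi a)                                      ∎

  inverse-lo-hi : ∀ {a b} → isInv a b ≡ true → lo b ≡ lo a × hi b ≡ hi a
  inverse-lo-hi {a} {b} b⁻ = inΦ-inA²⇒lo-hi {b} (lo-hi-inΦ a)
    (P.trans (inA²-reverse (lo a) (hi a) (proj₁ (isInv-sound b⁻)) (proj₂ (isInv-sound b⁻))) (lo-hi-inA² a))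

  inverse-inA² : ∀ {a b} → isInv a b ≡ true → inA² (lo a) (hi a) b ≡ true
  inverse-inA² {a} {b} b⁻ = P.subst₂ (λ x y → inA² x y b ≡ true)
    (proj₁ (inverse-lo-hi b⁻)) (proj₂ (inverse-lo-hi b⁻)) (lo-hi-inA² b)

  lo≟hi : ∀ a → ⌊ lo a ≟ hi a ⌋ ≡ ⌊ tl a ≟ hd a ⌋
  lo≟hi a with endpoints a
  ... | forward  _ lo≡ hi≡ = P.cong₂ (λ x y → ⌊ x ≟ y ⌋) lo≡ hi≡
  ... | backward _ lo≡ hi≡ = P.trans (P.cong₂ (λ x y → ⌊ x ≟ y ⌋) lo≡ hi≡) (≟-sym (hd a) (tl a))

  -- The inverse of I + tJ

  J : Arc → Arc → Carrier
  J = Jₑ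

  J-guard : ∀ {a b x y} → (isInv a b ≡ true → x ≈ y) → J a b * x ≈ J a b * y
  J-guard {a} {b} x≈y with isInv a b
  ... | true  = *-congˡ (x≈y P.refl)
  ... | false = trans (zeroˡ _) (sym (zeroˡ _))

  J² : Arc → Arc → Carrier
  J² a c = Σ (λ b → J a b * J b c)

  J²-val : ∀ a c → J² a c ≈ card (hd a) (tl a) * [ inA (tl a) (hd a) c ]
  J²-val a c = begin
    Σ (λ b → J a b * J b c)                      ≈⟨ Σ-cong {nA} (λ b → J-guard {a} {b} λ b⁻ →
                                                      let tl≡hd , hd≡tl = isInv-sound b⁻ in
                                                      reflexive (P.cong [_] (P.cong₂ (λ x y → inA x y c) hd≡tl tl≡hd))) ⟩
    Σ (λ b → J a b * [ inA (tl a) (hd a) c ])    ≈⟨ sym (Σ-distribʳ _ (J a)) ⟩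
    card (hd a) (tl a) * [ inA (tl a) (hd a) c ] ∎

  J³ : Arc → Arc → Carrier
  J³ a c = Σ (λ b → J a b * J² b c)

  J³-val : ∀ a c → J³ a c ≈ card (hd a) (tl a) * card (tl a) (hd a) * J a c
  J³-val a c = begin
    Σ (λ b → J a b * J² b c)                           ≈⟨ Σ-cong {nA} (λ b → J-guard {a} {b} λ b⁻ →
                                                            let tl≡hd , hd≡tl = isInv-sound b⁻ in
                                                            trans (J²-val b c) (reflexive (P.cong₂ (λ x y → card x y * [ inA y x c ]) hd≡tl tl≡hd))) ⟩
    Σ (λ b → J a b * (card (tl a) (hd a) * J a c))     ≈⟨ sym (Σ-distribʳ _ (J a)) ⟩
    card (hd a) (tl a) * (card (tl a) (hd a) * J a c)  ≈⟨ sym (*-assoc _ _ _) ⟩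
    card (hd a) (tl a) * card (tl a) (hd a) * J a c    ∎

  J²-loop : ∀ a c → tl a ≡ hd a → J² a c ≈ card (hd a) (hd a) * J a c
  J²-loop a c tl≡hd = trans (J²-val a c) (reflexive (P.cong₂ (λ x y → card (hd a) x * [ inA x y c ]) tl≡hd (P.sym tl≡hd)))

  f-loop : ∀ u → f u u ≈ 1# + card u u * t
  f-loop u rewrite ≟-diag {i = u} P.refl = refl

  f-nonLoop : ∀ {u v} → u ≢ v → f u v ≈ 1# - card u v * card v u * (t * t)
  f-nonLoop u≢v rewrite ≟-≢ u≢v = refl

  fᵃ : Arc → Carrier
  fᵃ a = f (lo a) (hi a)

  fᵃ-loop : ∀ a → tl a ≡ hd a → fᵃ a ≈ 1# + card (hd a) (hd a) * t
  fᵃ-loop a tl≡hd with endpoints a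
  ... | forward  _ lo≡ hi≡ = trans (reflexive (P.cong₂ f (P.trans lo≡ tl≡hd) hi≡)) (f-loop (hd a))
  ... | backward _ lo≡ hi≡ = trans (reflexive (P.cong₂ f lo≡ (P.trans hi≡ tl≡hd))) (f-loop (hd a))

  fᵃ-nonLoop : ∀ a → tl a ≢ hd a → fᵃ a ≈ 1# - card (hd a) (tl a) * card (tl a) (hd a) * (t * t)
  fᵃ-nonLoop a tl≢hd with endpoints a
  ... | forward  _ lo≡ hi≡ = trans (reflexive (P.cong₂ f lo≡ hi≡))
                                   (trans (f-nonLoop tl≢hd) (+-congˡ (-‿cong (*-congʳ (*-comm _ _)))))
  ... | backward _ lo≡ hi≡ = trans (reflexive (P.cong₂ f lo≡ hi≡)) (f-nonLoop (tl≢hd ∘ P.sym))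

  fᵃ-inverse : ∀ {a b} → isInv a b ≡ true → fᵃ b ≡ fᵃ a
  fᵃ-inverse b⁻ = P.cong₂ f (proj₁ (inverse-lo-hi b⁻)) (proj₂ (inverse-lo-hi b⁻))

  nonLoop : Arc → Carrier
  nonLoop a = [ not ⌊ tl a ≟ hd a ⌋ ]

  nonLoop-inverse : ∀ {a b} → isInv a b ≡ true → nonLoop b ≈ nonLoop a
  nonLoop-inverse {a} {b} b⁻ = reflexive (P.cong (λ x → [ not x ])
    (P.trans (P.cong₂ (λ x y → ⌊ x ≟ y ⌋) tl≡hd hd≡tl) (≟-sym (hd a) (tl a))))
    where
    tl≡hd = proj₁ (isInv-sound b⁻)
    hd≡tl = proj₂ (isInv-sound b⁻)

  I+tJ : Arc → Arc → Carrier
  I+tJ a c = δ a c + t * J a c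

  -- On 𝒜(u,v), J³ = |𝒜uv||𝒜vu| J when u ≠ v and J² = |𝒜uu| J when u = v; this forces the
  -- inverse of I + tJ to be I - tJ/f + t²J²/f (without the last term at loops).
  [I+tJ]⁻¹ : Arc → Arc → Carrier
  [I+tJ]⁻¹ a c = δ a c - t * (J a c * fᵃ a ⁻¹) + t * t * (nonLoop a * (J² a c * fᵃ a ⁻¹))

  J[I+tJ]⁻¹ : ∀ a c → Σ (λ b → J a b * [I+tJ]⁻¹ b c) ≈ J a c - t * fᵃ a ⁻¹ * J² a c + t * t * nonLoop a * fᵃ a ⁻¹ * J³ a c
  J[I+tJ]⁻¹ a c = begin
    Σ (λ b → J a b * [I+tJ]⁻¹ b c)
      ≈⟨ Σ-cong {nA} term ⟩
    Σ (λ b → 1# * (J a b * δ b c) - t * fᵃ a ⁻¹ * (J a b * J b c) + t * t * nonLoop a * fᵃ a ⁻¹ * (J a b * J² b c))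
      ≈⟨ Σ-combination 1# (t * fᵃ a ⁻¹) (t * t * nonLoop a * fᵃ a ⁻¹) (λ b → J a b * δ b c) (λ b → J a b * J b c) (λ b → J a b * J² b c) ⟩
    1# * Σ (λ b → J a b * δ b c) - t * fᵃ a ⁻¹ * J² a c + t * t * nonLoop a * fᵃ a ⁻¹ * J³ a c
      ≈⟨ +-congʳ (+-congʳ (trans (*-identityˡ _) (Σ-δʳ c (J a)))) ⟩
    J a c - t * fᵃ a ⁻¹ * J² a c + t * t * nonLoop a * fᵃ a ⁻¹ * J³ a c ∎
    where
    term : ∀ b → J a b * [I+tJ]⁻¹ b c ≈
                 1# * (J a b * δ b c) - t * fᵃ a ⁻¹ * (J a b * J b c) + t * t * nonLoop a * fᵃ a ⁻¹ * (J a b * J² b c)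
    term b = trans (J-guard {a} {b} λ b⁻ → +-cong (+-congˡ (-‿cong (*-congˡ (*-congˡ (⁻¹-cong (reflexive (fᵃ-inverse b⁻)))))))
                                                  (*-congˡ (*-cong (nonLoop-inverse b⁻) (*-congˡ (⁻¹-cong (reflexive (fᵃ-inverse b⁻)))))))
      (solve 7 (λ j d tt jb i n j2 → j :* (d :- tt :* (jb :* i) :+ tt :* tt :* (n :* (j2 :* i)))
                 := con (+ 1) :* (j :* d) :- tt :* i :* (j :* jb) :+ tt :* tt :* n :* i :* (j :* j2))
               refl (J a b) (δ b c) t (J b c) (fᵃ a ⁻¹) (nonLoop a) (J² b c))

  [I+tJ]⁻¹-loop : ∀ a c → tl a ≡ hd a → fᵃ a * fᵃ a ⁻¹ ≈ 1# →
                  [I+tJ]⁻¹ a c + t * (J a c - t * fᵃ a ⁻¹ * J² a c + t * t * nonLoop a * fᵃ a ⁻¹ * J³ a c) ≈ δ a c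
  [I+tJ]⁻¹-loop a c tl≡hd f·f⁻¹≈1 = begin
    [I+tJ]⁻¹ a c + t * (J a c - t * fᵃ a ⁻¹ * J² a c + t * t * nonLoop a * fᵃ a ⁻¹ * J³ a c)
      ≈⟨ +-cong (+-congˡ (*-congˡ (*-cong loop0 (*-congʳ (J²-loop a c tl≡hd)))))
                (*-congˡ (+-cong (+-congˡ (-‿cong (*-congˡ (J²-loop a c tl≡hd)))) (*-congʳ (*-congʳ (*-congˡ loop0))))) ⟩
    δ a c - t * (J a c * fᵃ a ⁻¹) + t * t * (0# * (κ * J a c * fᵃ a ⁻¹))
      + t * (J a c - t * fᵃ a ⁻¹ * (κ * J a c) + t * t * 0# * fᵃ a ⁻¹ * J³ a c)
      ≈⟨ solve 6 (λ d tt j i k j3 → d :- tt :* (j :* i) :+ tt :* tt :* (con (+ 0) :* (k :* j :* i))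
                                    :+ tt :* (j :- tt :* i :* (k :* j) :+ tt :* tt :* con (+ 0) :* i :* j3)
                 := d :+ tt :* j :* (con (+ 1) :- (con (+ 1) :+ k :* tt) :* i))
               refl (δ a c) t (J a c) (fᵃ a ⁻¹) κ (J³ a c) ⟩
    δ a c + t * J a c * (1# - (1# + κ * t) * fᵃ a ⁻¹)
      ≈⟨ +-congˡ (*-congˡ (+-congˡ (-‿cong (trans (*-congʳ (sym (fᵃ-loop a tl≡hd))) f·f⁻¹≈1)))) ⟩
    δ a c + t * J a c * (1# - 1#)
      ≈⟨ solve 3 (λ d tt j → d :+ tt :* j :* (con (+ 1) :- con (+ 1)) := d) refl (δ a c) t (J a c) ⟩
    δ a c ∎
    where
    κ = card (hd a) (hd a)
    loop0 : nonLoop a ≈ 0#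
    loop0 = []-false (P.cong not (≟-diag tl≡hd))

  [I+tJ]⁻¹-nonLoop : ∀ a c → tl a ≢ hd a → fᵃ a * fᵃ a ⁻¹ ≈ 1# →
                     [I+tJ]⁻¹ a c + t * (J a c - t * fᵃ a ⁻¹ * J² a c + t * t * nonLoop a * fᵃ a ⁻¹ * J³ a c) ≈ δ a c
  [I+tJ]⁻¹-nonLoop a c tl≢hd f·f⁻¹≈1 = begin
    [I+tJ]⁻¹ a c + t * (J a c - t * fᵃ a ⁻¹ * J² a c + t * t * nonLoop a * fᵃ a ⁻¹ * J³ a c)
      ≈⟨ +-cong (+-congˡ (*-congˡ (*-congʳ nonLoop1)))
                (*-congˡ (+-congˡ (*-cong (*-congʳ (*-congˡ nonLoop1)) (J³-val a c)))) ⟩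
    δ a c - t * (J a c * fᵃ a ⁻¹) + t * t * (1# * (J² a c * fᵃ a ⁻¹))
      + t * (J a c - t * fᵃ a ⁻¹ * J² a c + t * t * 1# * fᵃ a ⁻¹ * (κ₁ * κ₂ * J a c))
      ≈⟨ solve 7 (λ d tt j i j2 k₁ k₂ → d :- tt :* (j :* i) :+ tt :* tt :* (con (+ 1) :* (j2 :* i))
                                        :+ tt :* (j :- tt :* i :* j2 :+ tt :* tt :* con (+ 1) :* i :* (k₁ :* k₂ :* j))
                 := d :+ tt :* j :* (con (+ 1) :- (con (+ 1) :- k₁ :* k₂ :* (tt :* tt)) :* i))
               refl (δ a c) t (J a c) (fᵃ a ⁻¹) (J² a c) κ₁ κ₂ ⟩
    δ a c + t * J a c * (1# - (1# - κ₁ * κ₂ * (t * t)) * fᵃ a ⁻¹)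
      ≈⟨ +-congˡ (*-congˡ (+-congˡ (-‿cong (trans (*-congʳ (sym (fᵃ-nonLoop a tl≢hd))) f·f⁻¹≈1)))) ⟩
    δ a c + t * J a c * (1# - 1#)
      ≈⟨ solve 3 (λ d tt j → d :+ tt :* j :* (con (+ 1) :- con (+ 1)) := d) refl (δ a c) t (J a c) ⟩
    δ a c ∎
    where
    κ₁ = card (hd a) (tl a)
    κ₂ = card (tl a) (hd a)
    nonLoop1 : nonLoop a ≈ 1#
    nonLoop1 = []-true (P.cong not (≟-≢ tl≢hd))

  I+tJ-inverse : (∀ u v → inΦ u v ≡ true → ¬ f u v ≈ 0#) →
                 ∀ a c → Σ (λ b → I+tJ a b * [I+tJ]⁻¹ b c) ≈ δ a c
  I+tJ-inverse f≉0 a c = begin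
    Σ (λ b → I+tJ a b * [I+tJ]⁻¹ b c)
      ≈⟨ Σ-cong {nA} (λ b → trans (distribʳ _ _ _) (+-congˡ (*-assoc _ _ _))) ⟩
    Σ (λ b → δ a b * [I+tJ]⁻¹ b c + t * (J a b * [I+tJ]⁻¹ b c))
      ≈⟨ Σ-+ (λ b → δ a b * [I+tJ]⁻¹ b c) _ ⟩
    Σ (λ b → δ a b * [I+tJ]⁻¹ b c) + Σ (λ b → t * (J a b * [I+tJ]⁻¹ b c))
      ≈⟨ +-cong (Σ-δˡ a (λ b → [I+tJ]⁻¹ b c)) (sym (Σ-distribˡ {nA} t _)) ⟩
    [I+tJ]⁻¹ a c + t * Σ (λ b → J a b * [I+tJ]⁻¹ b c)
      ≈⟨ +-congˡ (*-congˡ (J[I+tJ]⁻¹ a c)) ⟩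
    [I+tJ]⁻¹ a c + t * (J a c - t * fᵃ a ⁻¹ * J² a c + t * t * nonLoop a * fᵃ a ⁻¹ * J³ a c)
      ≈⟨ byLoop (tl a ≟ hd a) ⟩
    δ a c ∎
    where
    f·f⁻¹≈1 : fᵃ a * fᵃ a ⁻¹ ≈ 1#
    f·f⁻¹≈1 = ⁻¹-inverse (fᵃ a) (f≉0 (lo a) (hi a) (lo-hi-inΦ a))
    byLoop : Dec (tl a ≡ hd a) → [I+tJ]⁻¹ a c + t * (J a c - t * fᵃ a ⁻¹ * J² a c + t * t * nonLoop a * fᵃ a ⁻¹ * J³ a c) ≈ δ a c
    byLoop (yes tl≡hd) = [I+tJ]⁻¹-loop a c tl≡hd f·f⁻¹≈1
    byLoop (no tl≢hd)  = [I+tJ]⁻¹-nonLoop a c tl≢hd f·f⁻¹≈1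

  -- The Schur complement of I + tJ in the bordered matrix

  LJK-term : V → V → Arc → Arc → Carrier
  LJK-term w w′ a b = Lₑ w a * Jₑ a b * Kₑ b w′

  LJJK-term : V → V → Arc → Arc → Arc → Carrier
  LJJK-term w w′ a c b = Lₑ w a * Jₑ a c * Jₑ c b * Kₑ b w′

  Aθ-val : ∀ w w′ → Aθ w w′ ≈ Σ (λ a → Lₑ w a * Kₑ a w′)
  Aθ-val w w′ = begin
    Σ (λ u → Σ (λ v → [ inΦ u v ] * Σ (λ a → [ inA² u v a ] * (Lₑ w a * Kₑ a w′))))
      ≈⟨ Σ²-interchange (λ u v → [ inΦ u v ]) (λ a u v → [ inA² u v a ] * (Lₑ w a * Kₑ a w′)) ⟩
    Σ (λ a → Σ (λ u → Σ (λ v → [ inΦ u v ] * ([ inA² u v a ] * (Lₑ w a * Kₑ a w′)))))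
      ≈⟨ Σ-cong {nA} (λ a → Σ-Φ-containing a (λ _ _ → Lₑ w a * Kₑ a w′)) ⟩
    Σ (λ a → Lₑ w a * Kₑ a w′) ∎

  Dθ-val : ∀ w w′ → Dθ w w′ ≈ Σ (λ a → Σ (λ b → Lₑ w a * (J a b * fᵃ a ⁻¹) * Kₑ b w′))
  Dθ-val w w′ = begin
    Σ (λ u → Σ (λ v → [ inΦ u v ] * (LJK u v w w′ * f u v ⁻¹)))
      ≈⟨ Σ-cong {nV} (λ u → Σ-cong {nV} λ v → *-congˡ (perArc u v)) ⟩
    Σ (λ u → Σ (λ v → [ inΦ u v ] * Σ (λ a → [ inA² u v a ] * Y a u v)))
      ≈⟨ Σ²-interchange (λ u v → [ inΦ u v ]) (λ a u v → [ inA² u v a ] * Y a u v) ⟩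
    Σ (λ a → Σ (λ u → Σ (λ v → [ inΦ u v ] * ([ inA² u v a ] * Y a u v))))
      ≈⟨ Σ-cong {nA} (λ a → trans (Σ-Φ-containing a (Y a)) (Σ-cong {nA} (inBlock a))) ⟩
    Σ (λ a → Σ (λ b → Lₑ w a * (J a b * fᵃ a ⁻¹) * Kₑ b w′)) ∎
    where
    Y : Arc → V → V → Carrier
    Y a u v = Σ (λ b → [ inA² u v b ] * (LJK-term w w′ a b * f u v ⁻¹))
    perArc : ∀ u v → LJK u v w w′ * f u v ⁻¹ ≈ Σ (λ a → [ inA² u v a ] * Y a u v)
    perArc u v = begin
      Σ (λ a → Σ (λ b → [ inA² u v a ] * [ inA² u v b ] * LJK-term w w′ a b)) * f u v ⁻¹
        ≈⟨ Σ-distribʳ {nA} (f u v ⁻¹) _ ⟩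
      Σ (λ a → Σ (λ b → [ inA² u v a ] * [ inA² u v b ] * LJK-term w w′ a b) * f u v ⁻¹)
        ≈⟨ Σ-cong {nA} (λ a → trans (Σ-distribʳ {nA} (f u v ⁻¹) _) (trans (Σ-cong {nA} λ b → *-assoc² _ _ _ _)
                                     (sym (Σ-distribˡ {nA} [ inA² u v a ] _)))) ⟩
      Σ (λ a → [ inA² u v a ] * Y a u v) ∎
    inBlock : ∀ a b → [ inA² (lo a) (hi a) b ] * (LJK-term w w′ a b * fᵃ a ⁻¹) ≈ Lₑ w a * (J a b * fᵃ a ⁻¹) * Kₑ b w′
    inBlock a b = begin
      [ inA² (lo a) (hi a) b ] * (LJK-term w w′ a b * fᵃ a ⁻¹)
        ≈⟨ solve 5 (λ m l j k i → m :* (l :* j :* k :* i) := j :* (m :* (l :* k :* i))) refl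
                   [ inA² (lo a) (hi a) b ] (Lₑ w a) (J a b) (Kₑ b w′) (fᵃ a ⁻¹) ⟩
      J a b * ([ inA² (lo a) (hi a) b ] * (Lₑ w a * Kₑ b w′ * fᵃ a ⁻¹))
        ≈⟨ J-guard {a} {b} (λ b⁻ → trans (*-congʳ ([]-true (inverse-inA² b⁻))) (*-identityˡ _)) ⟩
      J a b * (Lₑ w a * Kₑ b w′ * fᵃ a ⁻¹)
        ≈⟨ solve 4 (λ j l k i → j :* (l :* k :* i) := l :* (j :* i) :* k) refl (J a b) (Lₑ w a) (Kₑ b w′) (fᵃ a ⁻¹) ⟩
      Lₑ w a * (J a b * fᵃ a ⁻¹) * Kₑ b w′ ∎

  LJJK-term-inBlock : ∀ w w′ a c b → [ inA² (lo a) (hi a) c ] * [ inA² (lo a) (hi a) b ] * (LJJK-term w w′ a c b * fᵃ a ⁻¹) ≈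
                              LJJK-term w w′ a c b * fᵃ a ⁻¹
  LJJK-term-inBlock w w′ a c b = begin
    [ inA² (lo a) (hi a) c ] * [ inA² (lo a) (hi a) b ] * (LJJK-term w w′ a c b * fᵃ a ⁻¹)
      ≈⟨ solve 7 (λ x y l j₁ j₂ k i → x :* y :* (l :* j₁ :* j₂ :* k :* i) := j₁ :* (j₂ :* (x :* y :* (l :* k :* i)))) refl
                 [ inA² (lo a) (hi a) c ] [ inA² (lo a) (hi a) b ] (Lₑ w a) (J a c) (J c b) (Kₑ b w′) (fᵃ a ⁻¹) ⟩
    J a c * (J c b * ([ inA² (lo a) (hi a) c ] * [ inA² (lo a) (hi a) b ] * (Lₑ w a * Kₑ b w′ * fᵃ a ⁻¹)))
      ≈⟨ J-guard {a} {c} (λ c⁻ → J-guard {c} {b} λ b⁻ → trans (*-congʳ (*-cong ([]-true (inverse-inA² c⁻))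
           ([]-true (P.subst₂ (λ x y → inA² x y b ≡ true) (proj₁ (inverse-lo-hi c⁻)) (proj₂ (inverse-lo-hi c⁻)) (inverse-inA² b⁻)))))
           (trans (*-congʳ (*-identityˡ 1#)) (*-identityˡ _))) ⟩
    J a c * (J c b * (Lₑ w a * Kₑ b w′ * fᵃ a ⁻¹))
      ≈⟨ solve 5 (λ j₁ j₂ l k i → j₁ :* (j₂ :* (l :* k :* i)) := l :* j₁ :* j₂ :* k :* i) refl
                 (J a c) (J c b) (Lₑ w a) (Kₑ b w′) (fᵃ a ⁻¹) ⟩
    LJJK-term w w′ a c b * fᵃ a ⁻¹ ∎

  Xθ-val : ∀ w w′ → Xθ w w′ ≈ Σ (λ a → Σ (λ b → Lₑ w a * (nonLoop a * (J² a b * fᵃ a ⁻¹)) * Kₑ b w′))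
  Xθ-val w w′ = begin
    Σ (λ u → Σ (λ v → [ inΦ u v ∧ not ⌊ u ≟ v ⌋ ] * (LJJK u v w w′ * f u v ⁻¹)))
      ≈⟨ Σ-cong {nV} (λ u → Σ-cong {nV} λ v → perBlock u v) ⟩
    Σ (λ u → Σ (λ v → [ inΦ u v ] * Σ (λ a → [ inA² u v a ] * Z a u v)))
      ≈⟨ Σ²-interchange (λ u v → [ inΦ u v ]) (λ a u v → [ inA² u v a ] * Z a u v) ⟩
    Σ (λ a → Σ (λ u → Σ (λ v → [ inΦ u v ] * ([ inA² u v a ] * Z a u v))))
      ≈⟨ Σ-cong {nA} (λ a → trans (Σ-Φ-containing a (Z a)) (inBlock a)) ⟩
    Σ (λ a → Σ (λ b → Lₑ w a * (nonLoop a * (J² a b * fᵃ a ⁻¹)) * Kₑ b w′)) ∎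
    where
    in² : V → V → Arc → Carrier
    in² u v a = [ inA² u v a ]
    Y : Arc → V → V → Carrier
    Y a u v = Σ (λ c → Σ (λ b → in² u v c * in² u v b * (LJJK-term w w′ a c b * f u v ⁻¹)))
    Z : Arc → V → V → Carrier
    Z a u v = [ not ⌊ u ≟ v ⌋ ] * Y a u v
    perArc : ∀ u v a → Σ (λ c → Σ (λ b → in² u v a * in² u v c * in² u v b * LJJK-term w w′ a c b)) * f u v ⁻¹ ≈ in² u v a * Y a u v
    perArc u v a = begin
      Σ (λ c → Σ (λ b → in² u v a * in² u v c * in² u v b * LJJK-term w w′ a c b)) * f u v ⁻¹
        ≈⟨ trans (Σ-distribʳ {nA} _ _) (Σ-cong {nA} λ c → Σ-distribʳ {nA} _ _) ⟩
      Σ (λ c → Σ (λ b → in² u v a * in² u v c * in² u v b * LJJK-term w w′ a c b * f u v ⁻¹))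
        ≈⟨ Σ-cong {nA} (λ c → trans (Σ-cong {nA} λ b → solve 5 (λ x y z e i → x :* y :* z :* e :* i := x :* (y :* z :* (e :* i))) refl
                                                          (in² u v a) (in² u v c) (in² u v b) (LJJK-term w w′ a c b) (f u v ⁻¹))
                                     (sym (Σ-distribˡ {nA} (in² u v a) _))) ⟩
      Σ (λ c → in² u v a * Σ (λ b → in² u v c * in² u v b * (LJJK-term w w′ a c b * f u v ⁻¹)))
        ≈⟨ sym (Σ-distribˡ {nA} (in² u v a) _) ⟩
      in² u v a * Y a u v ∎
    perBlock : ∀ u v → [ inΦ u v ∧ not ⌊ u ≟ v ⌋ ] * (LJJK u v w w′ * f u v ⁻¹) ≈ [ inΦ u v ] * Σ (λ a → in² u v a * Z a u v)
    perBlock u v = begin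
      [ inΦ u v ∧ not ⌊ u ≟ v ⌋ ] * (LJJK u v w w′ * f u v ⁻¹)
        ≈⟨ trans (*-congʳ ([]-∧ (inΦ u v) _)) (*-assoc _ _ _) ⟩
      [ inΦ u v ] * ([ not ⌊ u ≟ v ⌋ ] * (LJJK u v w w′ * f u v ⁻¹))
        ≈⟨ *-congˡ (*-congˡ (trans (Σ-distribʳ {nA} _ _) (Σ-cong {nA} (perArc u v)))) ⟩
      [ inΦ u v ] * ([ not ⌊ u ≟ v ⌋ ] * Σ (λ a → in² u v a * Y a u v))
        ≈⟨ *-congˡ (trans (Σ-distribˡ {nA} _ _) (Σ-cong {nA} λ a → solve 3 (λ n x y → n :* (x :* y) := x :* (n :* y)) refl
                                                                         [ not ⌊ u ≟ v ⌋ ] (in² u v a) (Y a u v))) ⟩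
      [ inΦ u v ] * Σ (λ a → in² u v a * Z a u v) ∎
    inBlock : ∀ a → Z a (lo a) (hi a) ≈ Σ (λ b → Lₑ w a * (nonLoop a * (J² a b * fᵃ a ⁻¹)) * Kₑ b w′)
    inBlock a = begin
      [ not ⌊ lo a ≟ hi a ⌋ ] * Σ (λ c → Σ (λ b → in² (lo a) (hi a) c * in² (lo a) (hi a) b * (LJJK-term w w′ a c b * f⁻¹)))
        ≈⟨ *-cong (reflexive (P.cong (λ z → [ not z ]) (lo≟hi a))) (Σ-cong {nA} λ c → Σ-cong {nA} λ b → LJJK-term-inBlock w w′ a c b) ⟩
      nonLoop a * Σ (λ c → Σ (λ b → LJJK-term w w′ a c b * f⁻¹))
        ≈⟨ trans (*-congˡ (Σ-comm (λ c b → LJJK-term w w′ a c b * f⁻¹))) (Σ-distribˡ {nA} (nonLoop a) _) ⟩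
      Σ (λ b → nonLoop a * Σ (λ c → LJJK-term w w′ a c b * f⁻¹))
        ≈⟨ Σ-cong {nA} regroup ⟩
      Σ (λ b → Lₑ w a * (nonLoop a * (J² a b * f⁻¹)) * Kₑ b w′) ∎
      where
      f⁻¹ = fᵃ a ⁻¹
      regroup : ∀ b → nonLoop a * Σ (λ c → LJJK-term w w′ a c b * f⁻¹) ≈ Lₑ w a * (nonLoop a * (J² a b * f⁻¹)) * Kₑ b w′
      regroup b = begin
        nonLoop a * Σ (λ c → LJJK-term w w′ a c b * f⁻¹)
          ≈⟨ *-congˡ (Σ-cong {nA} λ c → solve 5 (λ l j₁ j₂ k i → l :* j₁ :* j₂ :* k :* i := (j₁ :* j₂) :* (l :* k :* i)) refl
                                                 (Lₑ w a) (J a c) (J c b) (Kₑ b w′) f⁻¹) ⟩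
        nonLoop a * Σ (λ c → J a c * J c b * (Lₑ w a * Kₑ b w′ * f⁻¹))
          ≈⟨ *-congˡ (sym (Σ-distribʳ (Lₑ w a * Kₑ b w′ * f⁻¹) (λ c → J a c * J c b))) ⟩
        nonLoop a * (J² a b * (Lₑ w a * Kₑ b w′ * f⁻¹))
          ≈⟨ solve 5 (λ n j₂ l k i → n :* (j₂ :* (l :* k :* i)) := l :* (n :* (j₂ :* i)) :* k) refl
                     (nonLoop a) (J² a b) (Lₑ w a) (Kₑ b w′) f⁻¹ ⟩
        Lₑ w a * (nonLoop a * (J² a b * f⁻¹)) * Kₑ b w′ ∎

  L[I+tJ]⁻¹tK : ∀ w w′ → Σ (λ a → Lₑ w a * Σ (λ b → [I+tJ]⁻¹ a b * (t * Kₑ b w′))) ≈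
                         t * Aθ w w′ - t * t * Dθ w w′ + t * t * t * Xθ w w′
  L[I+tJ]⁻¹tK w w′ = begin
    Σ (λ a → Lₑ w a * Σ (λ b → [I+tJ]⁻¹ a b * (t * Kₑ b w′)))
      ≈⟨ Σ-cong {nA} (λ a → trans (Σ-distribˡ {nA} (Lₑ w a) _)
                           (trans (Σ-cong {nA} (term a)) (Σ-combination t (t * t) (t * t * t) (p a) (q a) (s a)))) ⟩
    Σ (λ a → t * Σ (p a) - t * t * Σ (q a) + t * t * t * Σ (s a))
      ≈⟨ Σ-combination t (t * t) (t * t * t) (λ a → Σ (p a)) (λ a → Σ (q a)) (λ a → Σ (s a)) ⟩
    t * Σ (λ a → Σ (p a)) - t * t * Σ (λ a → Σ (q a)) + t * t * t * Σ (λ a → Σ (s a))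
      ≈⟨ sym (+-cong (+-cong (*-congˡ (trans (Aθ-val w w′) (Σ-cong {nA} diagonal))) (-‿cong (*-congˡ (Dθ-val w w′))))
                     (*-congˡ (Xθ-val w w′))) ⟩
    t * Aθ w w′ - t * t * Dθ w w′ + t * t * t * Xθ w w′ ∎
    where
    p q s : Arc → Arc → Carrier
    p a b = Lₑ w a * δ a b * Kₑ b w′
    q a b = Lₑ w a * (J a b * fᵃ a ⁻¹) * Kₑ b w′
    s a b = Lₑ w a * (nonLoop a * (J² a b * fᵃ a ⁻¹)) * Kₑ b w′
    term : ∀ a b → Lₑ w a * ([I+tJ]⁻¹ a b * (t * Kₑ b w′)) ≈ t * p a b - t * t * q a b + t * t * t * s a b
    term a b = solve 8 (λ l d j i n j2 k tt → l :* ((d :- tt :* (j :* i) :+ tt :* tt :* (n :* (j2 :* i))) :* (tt :* k))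
                          := tt :* (l :* d :* k) :- tt :* tt :* (l :* (j :* i) :* k) :+ tt :* tt :* tt :* (l :* (n :* (j2 :* i)) :* k))
                       refl (Lₑ w a) (δ a b) (J a b) (fᵃ a ⁻¹) (nonLoop a) (J² a b) (Kₑ b w′) t
    diagonal : ∀ a → Lₑ w a * Kₑ a w′ ≈ Σ (p a)
    diagonal a = sym (trans (Σ-cong {nA} λ b → *-assoc _ _ _)
                     (trans (sym (Σ-distribˡ {nA} (Lₑ w a) _)) (*-congˡ (Σ-δˡ a (λ b → Kₑ b w′)))))

  tK : Arc → V → Carrier
  tK a w = t * Kₑ a w

  bordered : Matrix (nA ℕ.+ nV)
  bordered = block I+tJ tK Lₑ δ

  det-bordered≈LHS : det bordered ≈ LHS
  det-bordered≈LHS = trans (det-blockWithIdentityCorner I+tJ tK Lₑ) (det-cong entry)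
    where
    entry : ∀ a a′ → I+tJ a a′ - Σ (λ w → tK a w * Lₑ w a′) ≈ δ a a′ - t * Mθ a a′
    entry a a′ = begin
      I+tJ a a′ - Σ (λ w → tK a w * Lₑ w a′)
        ≈⟨ +-congˡ (-‿cong (trans (Σ-cong {nV} λ w → solve 5 (λ tt t₁ d₁ t₂ d₂ → tt :* (t₁ :* d₁) :* (t₂ :* d₂)
                                                                                := d₁ :* (tt :* t₁ :* t₂ :* d₂)) refl
                                                          t (τ₁ a) (δ (hd a) w) (τ₂ a′) (δ w (tl a′)))
                                   (Σ-δˡ (hd a) (λ w → t * τ₁ a * τ₂ a′ * δ w (tl a′))))) ⟩
      δ a a′ + t * J a a′ - t * τ₁ a * τ₂ a′ * δ (hd a) (tl a′)
        ≈⟨ solve 6 (λ d tt j t₁ t₂ e → d :+ tt :* j :- tt :* t₁ :* t₂ :* e := d :- tt :* (t₁ :* t₂ :* e :- j)) refl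
                   (δ a a′) t (J a a′) (τ₁ a) (τ₂ a′) (δ (hd a) (tl a′)) ⟩
      δ a a′ - t * Mθ a a′ ∎

  reducedMatrix : Matrix nV
  reducedMatrix w w′ = δ w w′ - t * Aθ w w′ + t * t * Dθ w w′ - t * t * t * Xθ w w′

  det-bordered≈det[I+tJ]*det-reduced : (∀ u v → inΦ u v ≡ true → ¬ f u v ≈ 0#) → det bordered ≈ det I+tJ * det reducedMatrix
  det-bordered≈det[I+tJ]*det-reduced f≉0 =
    trans (det-blockWithInvertibleCorner I+tJ [I+tJ]⁻¹ tK Lₑ δ (I+tJ-inverse f≉0))
          (*-congˡ (det-cong entry))
    where
    entry : ∀ w w′ → δ w w′ - Σ (λ a → Lₑ w a * Σ (λ b → [I+tJ]⁻¹ a b * tK b w′)) ≈ reducedMatrix w w′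
    entry w w′ = trans (+-congˡ (-‿cong (L[I+tJ]⁻¹tK w w′)))
      (solve 5 (λ d tt a b x → d :- (tt :* a :- tt :* tt :* b :+ tt :* tt :* tt :* x) := d :- tt :* a :+ tt :* tt :* b :- tt :* tt :* tt :* x)
             refl (δ w w′) t (Aθ w w′) (Dθ w w′) (Xθ w w′))

  -- det (I + tJ) as a product over Φ_Δ

  lt : V → V → Bool
  lt u v = le u v ∧ not ⌊ u ≟ v ⌋

  lt-sound : ∀ {u v} → lt u v ≡ true → le u v ≡ true × u ≢ v
  lt-sound {u} {v} u<v = ∧-conicalˡ _ _ u<v , λ u≡v →
    contradiction (P.trans (P.sym (∧-conicalʳ (le u v) _ u<v)) (P.cong not (≟-diag u≡v))) λ ()

  le⇒¬lt : ∀ u v → le u v ≡ true → lt v u ≡ false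
  le⇒¬lt u v u≤v with le v u in v≤u
  ... | false = P.refl
  ... | true  = P.cong not (≟-diag (le-antisym v≤u u≤v))

  ¬le⇒lt : ∀ u v → le u v ≡ false → lt v u ≡ true
  ¬le⇒lt u v u≰v = ∧-intro (le-flip u≰v) (P.cong not (≟-≢ λ v≡u →
    contradiction (P.trans (P.sym u≰v) (P.subst (λ x → le u x ≡ true) (P.sym v≡u) (le-refl u))) λ ()))

  -- J = 𝒫𝒬 through the slots (u, v, s): slot (u, v, 0) holds 𝒜_uv when u ≤ v and slot (u, v, 1) holds
  -- 𝒜_vu when u < v, so every arc has exactly one slot, from which 𝒬 reaches its inverses.
  Slot : Set
  Slot = Fin (nV ℕ.* (nV ℕ.* 2))

  slot : V → V → Fin 2 → Slot
  slot u v s = combine u (combine v s)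

  𝒫′ : Arc → V → V → Fin 2 → Carrier
  𝒫′ a u v zero       = [ le u v ] * [ inA u v a ]
  𝒫′ a u v (suc zero) = [ lt u v ] * [ inA v u a ]

  𝒬′ : V → V → Fin 2 → Arc → Carrier
  𝒬′ u v zero       a = [ le u v ] * [ inA v u a ]
  𝒬′ u v (suc zero) a = [ lt u v ] * [ inA u v a ]

  unslot : Slot → V × V × Fin 2
  unslot x = map₂ (remQuot {nV} 2) (remQuot {nV} (nV ℕ.* 2) x)

  unslot-slot : ∀ u v s → unslot (slot u v s) ≡ (u , v , s)
  unslot-slot u v s = P.trans (P.cong (map₂ (remQuot {nV} 2)) (remQuot-combine u (combine v s)))
                              (P.cong (u ,_) (remQuot-combine v s))

  𝒫 : Arc → Slot → Carrier
  𝒫 a x = let u , v , s = unslot x in 𝒫′ a u v s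

  𝒬 : Slot → Arc → Carrier
  𝒬 x a = let u , v , s = unslot x in 𝒬′ u v s a

  𝒫-slot : ∀ a u v s → 𝒫 a (slot u v s) ≡ 𝒫′ a u v s
  𝒫-slot a u v s = P.cong (λ (u , v , s) → 𝒫′ a u v s) (unslot-slot u v s)

  𝒬-slot : ∀ a u v s → 𝒬 (slot u v s) a ≡ 𝒬′ u v s a
  𝒬-slot a u v s = P.cong (λ (u , v , s) → 𝒬′ u v s a) (unslot-slot u v s)

  Σ-slots : ∀ (g : Slot → Carrier) → Σ g ≈ Σ (λ u → Σ (λ v → Σ (λ s → g (slot u v s))))
  Σ-slots g = trans (Σ-combine {nV} {nV ℕ.* 2} g) (Σ-cong {nV} λ u → Σ-combine {nV} {2} (λ y → g (combine u y)))

  inA-δ : ∀ u v a → [ inA u v a ] ≈ δ (tl a) u * δ (hd a) v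
  inA-δ u v a = []-∧ ⌊ tl a ≟ u ⌋ ⌊ hd a ≟ v ⌋

  𝒫𝒬≈J : ∀ a a′ → Σ (λ x → 𝒫 a x * 𝒬 x a′) ≈ J a a′
  𝒫𝒬≈J a a′ = begin
    Σ (λ x → 𝒫 a x * 𝒬 x a′)
      ≈⟨ Σ-slots _ ⟩
    Σ (λ u → Σ (λ v → Σ (λ s → 𝒫 a (slot u v s) * 𝒬 (slot u v s) a′)))
      ≈⟨ Σ-cong {nV} (λ u → Σ-cong {nV} λ v → trans (+-congˡ (+-identityʳ _)) (+-cong (forwardSlot u v) (backwardSlot u v))) ⟩
    Σ (λ u → Σ (λ v → δ (tl a) u * δ (hd a) v * g₀ u v + δ (hd a) u * δ (tl a) v * g₁ u v))
      ≈⟨ trans (Σ-cong {nV} λ u → Σ-+ {nV} _ _) (Σ-+ {nV} _ _) ⟩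
    Σ (λ u → Σ (λ v → δ (tl a) u * δ (hd a) v * g₀ u v)) + Σ (λ u → Σ (λ v → δ (hd a) u * δ (tl a) v * g₁ u v))
      ≈⟨ +-cong (Σ-δ² (tl a) (hd a) g₀) (Σ-δ² (hd a) (tl a) g₁) ⟩
    [ le (tl a) (hd a) ] * J a a′ + [ lt (hd a) (tl a) ] * J a a′
      ≈⟨ sym (distribʳ _ _ _) ⟩
    ([ le (tl a) (hd a) ] + [ lt (hd a) (tl a) ]) * J a a′
      ≈⟨ *-congʳ ([]-+-exclusive _ _ (le⇒¬lt (tl a) (hd a)) (¬le⇒lt (tl a) (hd a))) ⟩
    1# * J a a′
      ≈⟨ *-identityˡ _ ⟩
    J a a′ ∎
    where
    g₀ g₁ : V → V → Carrier
    g₀ u v = [ le u v ] * [ inA v u a′ ]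
    g₁ u v = [ lt u v ] * [ inA u v a′ ]
    forwardSlot : ∀ u v → 𝒫 a (slot u v zero) * 𝒬 (slot u v zero) a′ ≈ δ (tl a) u * δ (hd a) v * g₀ u v
    forwardSlot u v = begin
      𝒫 a (slot u v zero) * 𝒬 (slot u v zero) a′
        ≡⟨ P.cong₂ _*_ (𝒫-slot a u v zero) (𝒬-slot a′ u v zero) ⟩
      [ le u v ] * [ inA u v a ] * ([ le u v ] * [ inA v u a′ ])
        ≈⟨ solve 4 (λ l i l′ j → l :* i :* (l′ :* j) := i :* (l :* l′ :* j)) refl [ le u v ] [ inA u v a ] [ le u v ] [ inA v u a′ ] ⟩
      [ inA u v a ] * ([ le u v ] * [ le u v ] * [ inA v u a′ ])
        ≈⟨ *-cong (inA-δ u v a) (*-congʳ ([]-idem (le u v))) ⟩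
      δ (tl a) u * δ (hd a) v * g₀ u v ∎
    backwardSlot : ∀ u v → 𝒫 a (slot u v (suc zero)) * 𝒬 (slot u v (suc zero)) a′ ≈ δ (hd a) u * δ (tl a) v * g₁ u v
    backwardSlot u v = begin
      𝒫 a (slot u v (suc zero)) * 𝒬 (slot u v (suc zero)) a′
        ≡⟨ P.cong₂ _*_ (𝒫-slot a u v (suc zero)) (𝒬-slot a′ u v (suc zero)) ⟩
      [ lt u v ] * [ inA v u a ] * ([ lt u v ] * [ inA u v a′ ])
        ≈⟨ solve 4 (λ l i l′ j → l :* i :* (l′ :* j) := i :* (l :* l′ :* j)) refl [ lt u v ] [ inA v u a ] [ lt u v ] [ inA u v a′ ] ⟩
      [ inA v u a ] * ([ lt u v ] * [ lt u v ] * [ inA u v a′ ])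
        ≈⟨ *-cong (trans (inA-δ v u a) (*-comm _ _)) (*-congʳ ([]-idem (lt u v))) ⟩
      δ (hd a) u * δ (tl a) v * g₁ u v ∎

  le∧inA²⇒lo-hi : ∀ {a u v} → le u v ≡ true → inA² u v a ≡ true → lo a ≡ u × hi a ≡ v
  le∧inA²⇒lo-hi {a} {u} {v} u≤v a∈uv = inΦ-inA²⇒lo-hi {a} (∧-intro u≤v (anyFin-intro (inA² u v) a a∈uv)) a∈uv

  𝒫′-support : ∀ a u v s → 𝒫′ a u v s ≈ 0# ⊎ (lo a ≡ u × hi a ≡ v)
  𝒫′-support a u v zero       = []-*-cases (le u v) (inA u v a) λ u≤v a∈ → le∧inA²⇒lo-hi u≤v (∨-introˡ a∈)
  𝒫′-support a u v (suc zero) = []-*-cases (lt u v) (inA v u a) λ u<v a∈ → le∧inA²⇒lo-hi (proj₁ (lt-sound u<v)) (∨-introʳ a∈)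

  𝒬′-support : ∀ a u v s → 𝒬′ u v s a ≈ 0# ⊎ (lo a ≡ u × hi a ≡ v)
  𝒬′-support a u v zero       = []-*-cases (le u v) (inA v u a) λ u≤v a∈ → le∧inA²⇒lo-hi u≤v (∨-introʳ a∈)
  𝒬′-support a u v (suc zero) = []-*-cases (lt u v) (inA u v a) λ u<v a∈ → le∧inA²⇒lo-hi (proj₁ (lt-sound u<v)) (∨-introˡ a∈)

  slotBlock : V → V → Fin 2 → Fin 2 → Carrier
  slotBlock u v s s′ = Σ (λ a → 𝒬′ u v s a * 𝒫′ a u v s′)

  𝒬𝒫-slots : ∀ u v s u′ v′ s′ → Σ (λ a → 𝒬′ u v s a * 𝒫′ a u′ v′ s′) ≈ δ u u′ * (δ v v′ * slotBlock u v s s′)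
  𝒬𝒫-slots u v s u′ v′ s′ = byCases (u ≟ u′) (v ≟ v′)
    where
    offBlock : ¬ (u ≡ u′ × v ≡ v′) → ∀ a → 𝒬′ u v s a * 𝒫′ a u′ v′ s′ ≈ 0#
    offBlock uv≢ a with 𝒬′-support a u v s | 𝒫′-support a u′ v′ s′
    ... | inj₁ 𝒬≈0 | _ = trans (*-congʳ 𝒬≈0) (zeroˡ _)
    ... | inj₂ _ | inj₁ 𝒫≈0 = trans (*-congˡ 𝒫≈0) (zeroʳ _)
    ... | inj₂ (lo≡u , hi≡v) | inj₂ (lo≡u′ , hi≡v′) =
      contradiction (P.trans (P.sym lo≡u) lo≡u′ , P.trans (P.sym hi≡v) hi≡v′) uv≢
    byCases : Dec (u ≡ u′) → Dec (v ≡ v′) → Σ (λ a → 𝒬′ u v s a * 𝒫′ a u′ v′ s′) ≈ δ u u′ * (δ v v′ * slotBlock u v s s′)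
    byCases (yes P.refl) (yes P.refl) = sym (trans (*-cong (δ-refl u) (trans (*-congʳ (δ-refl v)) (*-identityˡ _))) (*-identityˡ _))
    byCases (no u≢u′) _ = trans (Σ-zero {nA} (offBlock (u≢u′ ∘ proj₁))) (sym (trans (*-congʳ (δ-≢ u≢u′)) (zeroˡ _)))
    byCases (yes _) (no v≢v′) = trans (Σ-zero {nA} (offBlock (v≢v′ ∘ proj₂)))
                                      (sym (trans (*-congˡ (trans (*-congʳ (δ-≢ v≢v′)) (zeroˡ _))) (zeroʳ _)))

  twoByTwo : V → V → Matrix 2
  twoByTwo u v s s′ = δ s s′ + t * slotBlock u v s s′

  −t𝒫 : Arc → Slot → Carrier
  −t𝒫 a x = - t * 𝒫 a x

  I+t𝒬𝒫 : Matrix (nV ℕ.* (nV ℕ.* 2))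
  I+t𝒬𝒫 x x′ = δ x x′ - Σ (λ a → 𝒬 x a * Σ (λ b → δ a b * −t𝒫 b x′))

  I+t𝒬𝒫-slots : ∀ u v s u′ v′ s′ → I+t𝒬𝒫 (slot u v s) (slot u′ v′ s′) ≈ δ u u′ * (δ v v′ * twoByTwo u v s s′)
  I+t𝒬𝒫-slots u v s u′ v′ s′ = begin
    δ (slot u v s) (slot u′ v′ s′) - Σ (λ a → 𝒬 (slot u v s) a * Σ (λ b → δ a b * −t𝒫 b (slot u′ v′ s′)))
      ≈⟨ +-cong (trans (δ-combine u u′ (combine v s) (combine v′ s′)) (*-congˡ (δ-combine v v′ s s′)))
                (-‿cong (Σ-cong {nA} λ a → *-cong (reflexive (𝒬-slot a u v s))
                  (trans (Σ-δˡ a (λ b → −t𝒫 b (slot u′ v′ s′))) (*-congˡ (reflexive (𝒫-slot a u′ v′ s′)))))) ⟩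
    δ u u′ * (δ v v′ * δ s s′) - Σ (λ a → 𝒬′ u v s a * (- t * 𝒫′ a u′ v′ s′))
      ≈⟨ +-congˡ (-‿cong (trans (Σ-cong {nA} λ a → solve 3 (λ q tt p → q :* (:- tt :* p) := :- tt :* (q :* p)) refl
                                                          (𝒬′ u v s a) t (𝒫′ a u′ v′ s′))
                                (sym (Σ-distribˡ {nA} (- t) _)))) ⟩
    δ u u′ * (δ v v′ * δ s s′) - (- t * Σ (λ a → 𝒬′ u v s a * 𝒫′ a u′ v′ s′))
      ≈⟨ +-congˡ (-‿cong (*-congˡ (𝒬𝒫-slots u v s u′ v′ s′))) ⟩
    δ u u′ * (δ v v′ * δ s s′) - (- t * (δ u u′ * (δ v v′ * slotBlock u v s s′)))
      ≈⟨ solve 5 (λ a b c tt q → a :* (b :* c) :- (:- tt :* (a :* (b :* q))) := a :* (b :* (c :+ tt :* q))) refl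
                 (δ u u′) (δ v v′) (δ s s′) t (slotBlock u v s s′) ⟩
    δ u u′ * (δ v v′ * twoByTwo u v s s′) ∎

  card-empty : ∀ {u v} → anyFin (inA² u v) ≡ false → card u v ≈ 0#
  card-empty {u} {v} none = Σ-zero {nA} notIn
    where
    notIn : ∀ a → [ inA u v a ] ≈ 0#
    notIn a with inA u v a in a∈
    ... | false = refl
    ... | true  = contradiction (P.trans (P.sym none) (anyFin-intro (inA² u v) a (∨-introˡ a∈))) λ ()

  Σ-inA-same : ∀ p q x y → Σ (λ a → [ p ] * [ inA x y a ] * ([ q ] * [ inA x y a ])) ≈ [ p ] * [ q ] * card x y
  Σ-inA-same p q x y = trans (Σ-cong {nA} λ a → trans (solve 3 (λ p q i → p :* i :* (q :* i) := p :* q :* (i :* i)) refl [ p ] [ q ] [ inA x y a ])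
                                                  (*-congˡ ([]-idem (inA x y a))))
                         (sym (Σ-distribˡ {nA} ([ p ] * [ q ]) _))

  Σ-inA-opposite : ∀ p q {x y} → x ≢ y → Σ (λ a → [ p ] * [ inA x y a ] * ([ q ] * [ inA y x a ])) ≈ 0#
  Σ-inA-opposite p q {x} {y} x≢y = Σ-zero {nA} λ a → []-conjunction-zero p (inA x y a) q (inA y x a) λ _ a∈xy _ a∈yx →
    x≢y (P.trans (P.sym (proj₁ (inA-sound a∈xy))) (proj₁ (inA-sound a∈yx)))

  Φ-factor : V → V → Carrier
  Φ-factor u v = if inΦ u v then f u v else 1#

  private
    det₂ : Carrier → Carrier → Carrier → Carrier → Carrier
    det₂ q₀₀ q₁₁ q₀₁ q₁₀ = (1# + t * q₀₀) * (1# + t * q₁₁) - (0# + t * q₀₁) * (0# + t * q₁₀)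

  det-twoByTwo-unordered : ∀ u v → le u v ≡ false → det (twoByTwo u v) ≈ Φ-factor u v
  det-twoByTwo-unordered u v u≰v = begin
    det (twoByTwo u v)
      ≈⟨ det-2×2 (twoByTwo u v) ⟩
    det₂ (q zero zero) (q (suc zero) (suc zero)) (q zero (suc zero)) (q (suc zero) zero)
      ≈⟨ +-cong (*-cong (+-congˡ (*-congˡ (vanish zero zero))) (+-congˡ (*-congˡ (vanish (suc zero) (suc zero)))))
                (-‿cong (*-cong (+-congˡ (*-congˡ (vanish zero (suc zero)))) (+-congˡ (*-congˡ (vanish (suc zero) zero))))) ⟩
    det₂ 0# 0# 0# 0#
      ≈⟨ solve 1 (λ tt → (con (+ 1) :+ tt :* con (+ 0)) :* (con (+ 1) :+ tt :* con (+ 0))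
                         :- (con (+ 0) :+ tt :* con (+ 0)) :* (con (+ 0) :+ tt :* con (+ 0)) := con (+ 1)) refl t ⟩
    1#
      ≡⟨ P.cong (λ b → if b ∧ anyFin (inA² u v) then f u v else 1#) (P.sym u≰v) ⟩
    Φ-factor u v ∎
    where
    q = slotBlock u v
    vanish : ∀ s s′ → q s s′ ≈ 0#
    vanish zero       s′ = Σ-zero {nA} λ a → trans (*-congʳ (trans (*-congʳ ([]-false u≰v)) (zeroˡ _))) (zeroˡ _)
    vanish (suc zero) s′ = Σ-zero {nA} λ a → trans (*-congʳ (trans (*-congʳ ([]-false (P.cong (_∧ _) u≰v))) (zeroˡ _))) (zeroˡ _)

  det-twoByTwo-loop : ∀ u → det (twoByTwo u u) ≈ Φ-factor u u
  det-twoByTwo-loop u = begin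
    det (twoByTwo u u)
      ≈⟨ det-2×2 (twoByTwo u u) ⟩
    det₂ (q zero zero) (q (suc zero) (suc zero)) (q zero (suc zero)) (q (suc zero) zero)
      ≈⟨ +-cong (*-cong (+-congˡ (*-congˡ q₀₀)) (+-congˡ (*-congˡ (trans (Σ-inA-same (lt u u) (lt u u) u u) (lt-zeroˡ _)))))
                (-‿cong (*-cong (+-congˡ (*-congˡ (trans (Σ-inA-same (le u u) (lt u u) u u) (lt-zeroʳ _))))
                                (+-congˡ (*-congˡ (trans (Σ-inA-same (lt u u) (le u u) u u) (lt-zeroˡ _)))))) ⟩
    det₂ (card u u) 0# 0# 0#
      ≈⟨ solve 2 (λ tt κ → (con (+ 1) :+ tt :* κ) :* (con (+ 1) :+ tt :* con (+ 0))
                           :- (con (+ 0) :+ tt :* con (+ 0)) :* (con (+ 0) :+ tt :* con (+ 0)) := con (+ 1) :+ κ :* tt)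
                 refl t (card u u) ⟩
    1# + card u u * t
      ≈⟨ loopBlock (anyFin (inA² u u)) P.refl ⟩
    Φ-factor u u ∎
    where
    q = slotBlock u u
    u≤u = le-refl u
    u≮u : lt u u ≡ false
    u≮u = P.trans (P.cong (λ b → le u u ∧ not b) (≟-diag {i = u} P.refl)) (∧-zeroʳ (le u u))
    lt-zeroˡ : ∀ x → [ lt u u ] * x * card u u ≈ 0#
    lt-zeroˡ x = trans (*-congʳ (trans (*-congʳ ([]-false u≮u)) (zeroˡ _))) (zeroˡ _)
    lt-zeroʳ : ∀ x → x * [ lt u u ] * card u u ≈ 0#
    lt-zeroʳ x = trans (*-congʳ (trans (*-congˡ ([]-false u≮u)) (zeroʳ _))) (zeroˡ _)
    q₀₀ : q zero zero ≈ card u u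
    q₀₀ = trans (Σ-inA-same (le u u) (le u u) u u)
                (trans (*-congʳ (trans ([]-idem (le u u)) ([]-true u≤u))) (*-identityˡ _))
    loopBlock : ∀ b → anyFin (inA² u u) ≡ b → 1# + card u u * t ≈ Φ-factor u u
    loopBlock true  some = trans (sym (f-loop u)) (reflexive (P.cong (λ b → if b then f u u else 1#)
                                                                     (P.sym (∧-intro u≤u some))))
    loopBlock false none = trans (trans (+-congˡ (trans (*-congʳ (card-empty none)) (zeroˡ _))) (+-identityʳ _))
                                 (reflexive (P.cong (λ b → if b then f u u else 1#)
                                            (P.sym (P.trans (P.cong (_∧ anyFin (inA² u u)) u≤u) none))))

  det-twoByTwo-pair : ∀ u v → le u v ≡ true → u ≢ v → det (twoByTwo u v) ≈ Φ-factor u v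
  det-twoByTwo-pair u v u≤v u≢v = begin
    det (twoByTwo u v)
      ≈⟨ det-2×2 (twoByTwo u v) ⟩
    det₂ (q zero zero) (q (suc zero) (suc zero)) (q zero (suc zero)) (q (suc zero) zero)
      ≈⟨ +-cong (*-cong (+-congˡ (*-congˡ (Σ-inA-opposite (le u v) (le u v) (u≢v ∘ P.sym))))
                        (+-congˡ (*-congˡ (Σ-inA-opposite (lt u v) (lt u v) u≢v))))
                (-‿cong (*-cong (+-congˡ (*-congˡ (trans (Σ-inA-same (le u v) (lt u v) v u) one₁)))
                                (+-congˡ (*-congˡ (trans (Σ-inA-same (lt u v) (le u v) u v) one₂))))) ⟩
    det₂ 0# 0# (card v u) (card u v)
      ≈⟨ solve 3 (λ tt a b → (con (+ 1) :+ tt :* con (+ 0)) :* (con (+ 1) :+ tt :* con (+ 0))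
                             :- (con (+ 0) :+ tt :* a) :* (con (+ 0) :+ tt :* b) := con (+ 1) :- b :* a :* (tt :* tt))
                 refl t (card v u) (card u v) ⟩
    1# - card u v * card v u * (t * t)
      ≈⟨ pairBlock (anyFin (inA² u v)) P.refl ⟩
    Φ-factor u v ∎
    where
    q = slotBlock u v
    u<v : lt u v ≡ true
    u<v = ∧-intro u≤v (P.cong not (≟-≢ u≢v))
    one₁ : [ le u v ] * [ lt u v ] * card v u ≈ card v u
    one₁ = trans (*-congʳ (trans (*-cong ([]-true u≤v) ([]-true u<v)) (*-identityˡ _))) (*-identityˡ _)
    one₂ : [ lt u v ] * [ le u v ] * card u v ≈ card u v
    one₂ = trans (*-congʳ (trans (*-cong ([]-true u<v) ([]-true u≤v)) (*-identityˡ _))) (*-identityˡ _)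
    pairBlock : ∀ b → anyFin (inA² u v) ≡ b → 1# - card u v * card v u * (t * t) ≈ Φ-factor u v
    pairBlock true  some = trans (sym (f-nonLoop u≢v)) (reflexive (P.cong (λ b → if b then f u v else 1#)
                                                                          (P.sym (∧-intro u≤v some))))
    pairBlock false none = trans (trans (+-congˡ (-‿cong (trans (*-congʳ (trans (*-congʳ (card-empty none)) (zeroˡ _))) (zeroˡ _))))
                                        (trans (+-congˡ -0#≈0#) (+-identityʳ _)))
                                 (reflexive (P.cong (λ b → if b then f u v else 1#)
                                            (P.sym (P.trans (P.cong (_∧ anyFin (inA² u v)) u≤v) none))))

  det-twoByTwo : ∀ u v → det (twoByTwo u v) ≈ Φ-factor u v
  det-twoByTwo u v = byCases (le u v) P.refl (u ≟ v)
    where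
    byCases : ∀ b → le u v ≡ b → Dec (u ≡ v) → det (twoByTwo u v) ≈ Φ-factor u v
    byCases false u≰v _            = det-twoByTwo-unordered u v u≰v
    byCases true  _   (yes P.refl) = det-twoByTwo-loop u
    byCases true  u≤v (no u≢v)     = det-twoByTwo-pair u v u≤v u≢v

  Πf : Carrier
  Πf = Π (λ u → Π (λ v → Φ-factor u v))

  det-I+t𝒬𝒫 : det I+t𝒬𝒫 ≈ Πf
  det-I+t𝒬𝒫 = trans (det-blockDiagonal I+t𝒬𝒫 perVertex outer)
                    (Π-cong {nV} λ u → trans (det-blockDiagonal (perVertex u) (twoByTwo u) (inner u))
                                             (Π-cong {nV} (det-twoByTwo u)))
    where
    perVertex : V → Matrix (nV ℕ.* 2)
    perVertex u y y′ = I+t𝒬𝒫 (combine u y) (combine u y′)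
    inner : ∀ u v s v′ s′ → perVertex u (combine v s) (combine v′ s′) ≈ δ v v′ * twoByTwo u v s s′
    inner u v s v′ s′ = trans (I+t𝒬𝒫-slots u v s u v′ s′) (trans (*-congʳ (δ-refl u)) (*-identityˡ _))
    outer : ∀ u y u′ y′ → I+t𝒬𝒫 (combine u y) (combine u′ y′) ≈ δ u u′ * perVertex u y y′
    outer u y u′ y′ = begin
      I+t𝒬𝒫 (combine u y) (combine u′ y′)      ≡⟨ P.cong₂ (λ p q → I+t𝒬𝒫 (combine u p) (combine u′ q)) (P.sym y≡) (P.sym y′≡) ⟩
      I+t𝒬𝒫 (slot u v s) (slot u′ v′ s′)      ≈⟨ I+t𝒬𝒫-slots u v s u′ v′ s′ ⟩
      δ u u′ * (δ v v′ * twoByTwo u v s s′)    ≈⟨ *-congˡ (sym (inner u v s v′ s′)) ⟩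
      δ u u′ * perVertex u (combine v s) (combine v′ s′) ≡⟨ P.cong₂ (λ p q → δ u u′ * perVertex u p q) y≡ y′≡ ⟩
      δ u u′ * perVertex u y y′                ∎
      where
      v = proj₁ (remQuot {nV} 2 y)
      s = proj₂ (remQuot {nV} 2 y)
      v′ = proj₁ (remQuot {nV} 2 y′)
      s′ = proj₂ (remQuot {nV} 2 y′)
      y≡ : combine v s ≡ y
      y≡ = combine-remQuot {nV} 2 y
      y′≡ : combine v′ s′ ≡ y′
      y′≡ = combine-remQuot {nV} 2 y′

  -- Sylvester: both I + t𝒫𝒬 = I + tJ and I + t𝒬𝒫 are Schur complements in the block matrix
  -- with diagonal blocks I and off-diagonal blocks -t𝒫, 𝒬.
  det-I+tJ : det I+tJ ≈ Πf
  det-I+tJ = begin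
    det I+tJ                                             ≈⟨ det-cong entry ⟩
    det (λ a a′ → δ a a′ - Σ (λ x → −t𝒫 a x * 𝒬 x a′))   ≈⟨ sym (det-blockWithIdentityCorner δ −t𝒫 𝒬) ⟩
    det (block δ −t𝒫 𝒬 δ)                                ≈⟨ det-blockWithInvertibleCorner δ δ −t𝒫 𝒬 δ (λ i j → Σ-δˡ i (λ b → δ b j)) ⟩
    det {nA} δ * det I+t𝒬𝒫                               ≈⟨ *-cong (det-identity {nA} δ (λ _ _ → refl)) det-I+t𝒬𝒫 ⟩
    1# * Πf                                              ≈⟨ *-identityˡ _ ⟩
    Πf                                                   ∎
    where
    entry : ∀ a a′ → I+tJ a a′ ≈ δ a a′ - Σ (λ x → −t𝒫 a x * 𝒬 x a′)
    entry a a′ = sym (begin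
      δ a a′ - Σ (λ x → −t𝒫 a x * 𝒬 x a′)    ≈⟨ +-congˡ (-‿cong (trans (Σ-cong {nV ℕ.* (nV ℕ.* 2)} λ x → *-assoc _ _ _)
                                                                        (sym (Σ-distribˡ {nV ℕ.* (nV ℕ.* 2)} (- t) _)))) ⟩
      δ a a′ - (- t * Σ (λ x → 𝒫 a x * 𝒬 x a′)) ≈⟨ +-congˡ (-‿cong (*-congˡ (𝒫𝒬≈J a a′))) ⟩
      δ a a′ - (- t * J a a′)                ≈⟨ solve 3 (λ d tt j → d :- (:- tt :* j) := d :+ tt :* j) refl (δ a a′) t (J a a′) ⟩
      I+tJ a a′                              ∎)

theorem3p4 : ∀ {c ℓ r} (K : Field c ℓ) (Δ : Digraph)
    (τ₁ τ₂ : Fin (Digraph.nA Δ) → Field.Carrier K)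
    (_≼_ : Rel (Fin (Digraph.nV Δ)) r) (≼-dto : IsDecTotalOrder _≡_ _≼_)
    (t : Field.Carrier K) →
    (∀ u v → Construction.inΦ K Δ τ₁ τ₂ _≼_ ≼-dto t u v ≡ true →
      ¬ Field._≈_ K (Construction.f K Δ τ₁ τ₂ _≼_ ≼-dto t u v) (Field.0# K)) →
    Field._≈_ K (Construction.LHS K Δ τ₁ τ₂ _≼_ ≼-dto t)
                (Construction.RHS K Δ τ₁ τ₂ _≼_ ≼-dto t)
theorem3p4 K Δ τ₁ τ₂ _≼_ ≼-dto t f≉0 =
  trans (sym det-bordered≈LHS) (trans (det-bordered≈det[I+tJ]*det-reduced f≉0) (*-congʳ det-I+tJ))
  where
  open Proof K Δ τ₁ τ₂ _≼_ ≼-dto t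
  open Field K using (trans; sym; *-congʳ)
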